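{- Let $q$ be a prime power, $T$ a linear operator on $\mathbb{F}_q^n$, and let ${\mathsf m}_0,{\mathsf m}_1,{\mathsf m}_2:[n]\to[n]$ be Hessenberg functions satisfying one of the following two conditions: (1) there exists $i\in[n-1]$ such that ${\mathsf m}_1(i-1)<{\mathsf m}_1(i)<{\mathsf m}_1(i+1)$ (with the convention ${\mathsf m}_1(0)=0$) and ${\mathsf m}_1({\mathsf m}_1(i))={\mathsf m}_1({\mathsf m}_1(i)+1)$, and for $k\in\{0,2\}$ we have ${\mathsf m}_k(j)={\mathsf m}_1(j)$ for all $j\ne i$ and ${\mathsf m}_k(i)={\mathsf m}_1(i)-1+k$; (2) there exists $i\in[n-1]$ such that ${\mathsf m}_1(i+1)={\mathsf m}_1(i)+1$ and no $j$ satisfies ${\mathsf m}_1(j)=i$, and for $k\in\{0,2\}$ we have ${\mathsf m}_k(j)={\mathsf m}_1(j)$ for all $j\ne i,i+1$, while ${\mathsf m}_0(i)={\mathsf m}_0(i+1)={\mathsf m}_1(i)$ and ${\mathsf m}_2(i)={\mathsf m}_2(i+1)={\mathsf m}_1(i+1)$. Then $$(1+q)\,|\mathscr{H}({\mathsf m}_1,T)|=q\,|\mathscr{H}({\mathsf m}_0,T)|+|\mathscr{H}({\mathsf m}_2,T)|.$$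
   Context: A Hessenberg function is a weakly increasing ${\mathsf m}:[n]\to[n]$ with ${\mathsf m}(i)\ge i$ for all $i$. The Hessenberg variety $\mathscr{H}({\mathsf m},T)$ is the set of complete flags $V_1\subseteq\cdots\subseteq V_n=\mathbb{F}_q^n$ ($\dim V_i=i$) with $TV_i\subseteq V_{{\mathsf m}(i)}$ for all $i\in[n]$, and $|\mathscr{H}({\mathsf m},T)|$ is its (finite) number of elements. -}

module Defs where

open import Data.Nat using (ℕ; zero; suc; _+_; _*_; _∸_; _^_; _≤_; _<_)
open import Data.Fin using (Fin; combine) renaming (zero to fzero)
open import Data.Fin.Subset using (Subset; _∈_; _⊆_; ⊥)
open import Data.Vec using (Vec; []; _∷_; map; zipWith; replicate)
open import Data.List using (List; length; filter; concatMap) renaming ([] to []ˡ; _∷_ to _∷ˡ_)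
open import Data.Product using (Σ; ∃; _×_; _,_)
open import Data.Sum using (_⊎_)
open import Data.Bool using (Bool; true; false)
open import Relation.Binary.PropositionalEquality using (_≡_; _≢_)
open import Relation.Unary using (Decidable)
open import Algebra.Structures using (IsCommutativeRing)

-- A finite field with q elements, carried by Fin q (any finite field of
-- order q is isomorphic to one of this form).

record FiniteField (q : ℕ) : Set where
  field
    _+F_ : Fin q → Fin q → Fin q
    _*F_ : Fin q → Fin q → Fin q
    -F_  : Fin q → Fin q
    0F   : Fin q
    1F   : Fin q
    isCommutativeRing : IsCommutativeRing _≡_ _+F_ _*F_ -F_ 0F 1F
    0≢1     : 0F ≢ 1F
    inverse : ∀ x → x ≢ 0F → ∃ λ y → x *F y ≡ 1F

allVecs : ∀ {A : Set} → List A → (k : ℕ) → List (Vec A k)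
allVecs xs zero    = [] ∷ˡ []ˡ
allVecs xs (suc k) = concatMap (λ x → Data.List.map (x ∷_) (allVecs xs k)) xs

-- 1-based access: at d v j = v_j for 1 ≤ j ≤ length, and d otherwise
at : ∀ {A : Set} {n} → A → Vec A n → ℕ → A
at d v        zero          = d
at d []       (suc j)       = d
at d (x ∷ v)  (suc zero)    = x
at d (x ∷ v)  (suc (suc j)) = at d v (suc j)

-- Hessenberg functions m : [n] → [n], stored as the vector (m(1),…,m(n)).
-- m ⟨ j ⟩ = m(j) for j ∈ [n]; in particular m ⟨ 0 ⟩ = 0 (the convention m(0)=0).

_⟨_⟩ : ∀ {n} → Vec ℕ n → ℕ → ℕ
m ⟨ j ⟩ = at 0 m j

IsHessenberg : (n : ℕ) → Vec ℕ n → Set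
IsHessenberg n m =
    (∀ j → 1 ≤ j → j ≤ n → (j ≤ m ⟨ j ⟩) × (m ⟨ j ⟩ ≤ n))
  × (∀ j → 1 ≤ j → j < n → m ⟨ j ⟩ ≤ m ⟨ suc j ⟩)

Cond1 : (n : ℕ) → (m₀ m₁ m₂ : Vec ℕ n) → Set
Cond1 n m₀ m₁ m₂ = Σ ℕ λ i →
    1 ≤ i × i ≤ n ∸ 1
  × m₁ ⟨ i ∸ 1 ⟩ < m₁ ⟨ i ⟩ × m₁ ⟨ i ⟩ < m₁ ⟨ suc i ⟩
  × m₁ ⟨ m₁ ⟨ i ⟩ ⟩ ≡ m₁ ⟨ m₁ ⟨ i ⟩ + 1 ⟩
  × (∀ j → 1 ≤ j → j ≤ n → j ≢ i → (m₀ ⟨ j ⟩ ≡ m₁ ⟨ j ⟩) × (m₂ ⟨ j ⟩ ≡ m₁ ⟨ j ⟩))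
  × m₀ ⟨ i ⟩ ≡ m₁ ⟨ i ⟩ ∸ 1
  × m₂ ⟨ i ⟩ ≡ m₁ ⟨ i ⟩ + 1

Cond2 : (n : ℕ) → (m₀ m₁ m₂ : Vec ℕ n) → Set
Cond2 n m₀ m₁ m₂ = Σ ℕ λ i →
    1 ≤ i × i ≤ n ∸ 1
  × m₁ ⟨ i + 1 ⟩ ≡ m₁ ⟨ i ⟩ + 1
  × (∀ j → 1 ≤ j → j ≤ n → m₁ ⟨ j ⟩ ≢ i)
  × (∀ j → 1 ≤ j → j ≤ n → j ≢ i → j ≢ i + 1 → (m₀ ⟨ j ⟩ ≡ m₁ ⟨ j ⟩) × (m₂ ⟨ j ⟩ ≡ m₁ ⟨ j ⟩))
  × m₀ ⟨ i ⟩ ≡ m₁ ⟨ i ⟩ × m₀ ⟨ i + 1 ⟩ ≡ m₁ ⟨ i ⟩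
  × m₂ ⟨ i ⟩ ≡ m₁ ⟨ i + 1 ⟩ × m₂ ⟨ i + 1 ⟩ ≡ m₁ ⟨ i + 1 ⟩

module _ {q : ℕ} (𝔽 : FiniteField q) where
  open FiniteField 𝔽

  Vector : ℕ → Set
  Vector n = Vec (Fin q) n

  zeroV : ∀ n → Vector n
  zeroV n = replicate n 0F

  _+V_ : ∀ {n} → Vector n → Vector n → Vector n
  _+V_ = zipWith _+F_

  _·V_ : ∀ {n} → Fin q → Vector n → Vector n
  c ·V v = map (c *F_) v

  dot : ∀ {n} → Vector n → Vector n → Fin q
  dot []       []       = 0F
  dot (x ∷ u)  (y ∷ v)  = (x *F y) +F dot u v

  -- linear operators on F_q^n, as n×n matrices (list of rows)
  Matrix : ℕ → Set
  Matrix n = Vec (Vector n) n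

  apply : ∀ {n} → Matrix n → Vector n → Vector n
  apply T v = map (λ row → dot row v) T

  lincomb : ∀ {n k} → Vec (Fin q) k → Vec (Vector n) k → Vector n
  lincomb {n} []       []        = zeroV n
  lincomb     (c ∷ cs) (v ∷ vs)  = (c ·V v) +V lincomb cs vs

  -- subsets of F_q^n are subsets of Fin (q ^ n), via the (bijective)
  -- base-q coding of vectors
  code : ∀ {n} → Vector n → Fin (q ^ n)
  code []       = fzero
  code (x ∷ v)  = combine x (code v)

  SubsetV : ℕ → Set
  SubsetV n = Subset (q ^ n)

  _∈V_ : ∀ {n} → Vector n → SubsetV n → Set
  v ∈V S = code v ∈ S

  LinIndep : ∀ {n k} → Vec (Vector n) k → Set
  LinIndep {n} {k} vs = ∀ cs → lincomb cs vs ≡ zeroV n → cs ≡ replicate k 0F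

  IsSpanOf : ∀ {n k} → SubsetV n → Vec (Vector n) k → Set
  IsSpanOf {n} S vs = ∀ (v : Vector n) →
    (v ∈V S → ∃ λ cs → lincomb cs vs ≡ v) × ((∃ λ cs → lincomb cs vs ≡ v) → v ∈V S)

  IsSubspaceOfDim : ∀ {n} → SubsetV n → ℕ → Set
  IsSubspaceOfDim {n} S k = Σ (Vec (Vector n) k) λ vs → LinIndep vs × IsSpanOf S vs

  Flag : ℕ → Set
  Flag n = Vec (SubsetV n) n

  _⟪_⟫ : ∀ {n} → Flag n → ℕ → SubsetV n
  V ⟪ i ⟫ = at ⊥ V i

  IsCompleteFlag : ∀ {n} → Flag n → Set
  IsCompleteFlag {n} V =
      (∀ i → 1 ≤ i → i ≤ n → IsSubspaceOfDim {n} (V ⟪ i ⟫) i)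
    × (∀ i → 1 ≤ i → i < n → _⟪_⟫ {n} V i ⊆ _⟪_⟫ {n} V (suc i))

  InHess : ∀ {n} → Vec ℕ n → Matrix n → Flag n → Set
  InHess {n} m T V = IsCompleteFlag V
    × (∀ i → 1 ≤ i → i ≤ n → ∀ v → _∈V_ {n} v (V ⟪ i ⟫) → _∈V_ {n} (apply T v) (V ⟪ m ⟨ i ⟩ ⟫))

  allFlags : ∀ n → List (Flag n)
  allFlags n = allVecs (allVecs (true ∷ˡ false ∷ˡ []ˡ) (q ^ n)) n

  -- |H(m, T)| : the number of flags in the Hessenberg variety, computed
  -- using any decision procedure for membership (the result is independent
  -- of the decision procedure chosen)
  hessCount : ∀ {n} (m : Vec ℕ n) (T : Matrix n) → Decidable (InHess m T) → ℕ
  hessCount {n} m T dec = length (filter dec (allFlags n))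

{-# OPTIONS --safe #-}
module Submission where

-- Fix h and all V_j with j ≠ h (h = m₁(i) under condition (1), h = i under condition (2)).
-- Neither m₀ nor m₂ has a condition T V_j ⊆ V_h, and their condition on T V_h follows from
-- the one on T V_(h+1).  So on this fibre H(m₂) is empty or consists of all q + 1 subspaces
-- V_h between V_(h-1) and V_(h+1), and H(m₀) is empty or equal to it; when H(m₂) is nonempty
-- but H(m₀) is empty, exactly one V_h gives a flag in H(m₁).  In each case
-- (1 + q) |H(m₁)| = q |H(m₀)| + |H(m₂)| holds on the fibre, and summing over fibres gives it.

open import Defs
open import Algebra.Bundles using (AbelianGroup; CommutativeRing)
import Algebra.Properties.Group as GroupProperties
open import Algebra.Structures using (IsCommutativeRing; IsAbelianGroup)
open import Data.Bool using (true; false)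
import Data.Bool.Properties as Bool
open import Data.Empty using (⊥-elim)
open import Data.Fin using (Fin; toℕ; fromℕ<; combine; remQuot) renaming (zero to fzero; suc to fsuc)
import Data.Fin.Properties as Fin
open import Data.Fin.Subset using (_⊆_) renaming (_∈_ to _∈ᶠ_)
import Data.Fin.Subset.Properties as Subset
open import Data.List as List using (List) renaming ([] to []ˡ; _∷_ to _∷ˡ_)
open import Data.List.Membership.Propositional using (_∈_)
open import Data.List.Relation.Unary.Any using (here; there)
open import Data.Nat using (ℕ; zero; suc; _+_; _*_; _^_; _≤_; _<_; s≤s; z≤n)
import Data.Nat.Properties as ℕ
open import Algebra.Properties.CommutativeSemigroup ℕ.+-commutativeSemigroup using () renaming (interchange to +-interchange)
open import Data.Product using (∃; ∃!; _×_; _,_; proj₁; proj₂)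
open import Data.Sum using (_⊎_; inj₁; inj₂)
open import Data.Vec using (Vec; []; _∷_; map; head; tabulate; insertAt)
open import Data.Vec.Properties
  using (zipWith-assoc; zipWith-comm; zipWith-identityˡ; zipWith-identityʳ; zipWith-inverseˡ; zipWith-inverseʳ;
         ∷-injectiveˡ; ∷-injectiveʳ; lookup∘tabulate; []=⇒lookup; lookup⇒[]=)
import Data.Vec.Properties as Vec
open import Data.Vec.Relation.Unary.All as All using (All) renaming ([] to []ᴬ; _∷_ to _∷ᴬ_)
import Data.Vec.Relation.Unary.All.Properties as All
open import Function using (_∘_; case_of_)
open import Level using (0ℓ)
open import Relation.Binary.Definitions using (DecidableEquality; tri<; tri≈; tri>)
open import Relation.Binary.PropositionalEquality
open import Relation.Nullary using (¬_; Dec; yes; no; _×-dec_; ¬?)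
open import Relation.Nullary.Decidable using (does; decidable-stable)
open import Relation.Unary using (Decidable)

module VectorSpace {q : ℕ} (𝔽 : FiniteField q) where
  open FiniteField 𝔽
  open IsCommutativeRing isCommutativeRing
    using (+-assoc; +-comm; +-identityˡ; +-identityʳ; -‿inverseˡ; -‿inverseʳ;
           *-assoc; *-comm; *-identityˡ; distribˡ; distribʳ; zeroˡ; zeroʳ)

  𝔽-commutativeRing : CommutativeRing 0ℓ 0ℓ
  𝔽-commutativeRing = record { isCommutativeRing = isCommutativeRing }

  open CommutativeRing 𝔽-commutativeRing using (+-commutativeSemigroup; *-commutativeSemigroup)
  open import Algebra.Properties.CommutativeSemigroup +-commutativeSemigroup using ()
    renaming (interchange to +F-interchange)
  open import Algebra.Properties.CommutativeSemigroup *-commutativeSemigroup using ()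
    renaming (x∙yz≈y∙xz to *F-leftComm)

  𝕍 : ℕ → Set
  𝕍 = Vector 𝔽

  infixl 6 _⊕_
  infixr 7 _⊙_ _⊛_
  infix 8 ⊖_

  _⊕_ : ∀ {n} → 𝕍 n → 𝕍 n → 𝕍 n
  _⊕_ = _+V_ 𝔽

  _⊙_ : ∀ {n} → Fin q → 𝕍 n → 𝕍 n
  _⊙_ = _·V_ 𝔽

  ⊖_ : ∀ {n} → 𝕍 n → 𝕍 n
  ⊖_ = map -F_

  𝟎 : ∀ {n} → 𝕍 n
  𝟎 {n} = zeroV 𝔽 n

  _⊛_ : ∀ {n k} → Vec (Fin q) k → Vec (𝕍 n) k → 𝕍 n
  _⊛_ = lincomb 𝔽

  ⊕-isAbelianGroup : ∀ n → IsAbelianGroup _≡_ (_⊕_ {n}) 𝟎 ⊖_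
  ⊕-isAbelianGroup n = record
    { isGroup = record
      { isMonoid = record
        { isSemigroup = record
          { isMagma = record { isEquivalence = isEquivalence ; ∙-cong = cong₂ _⊕_ }
          ; assoc   = zipWith-assoc +-assoc }
        ; identity = zipWith-identityˡ +-identityˡ , zipWith-identityʳ +-identityʳ }
      ; inverse = zipWith-inverseˡ -‿inverseˡ , zipWith-inverseʳ -‿inverseʳ
      ; ⁻¹-cong = cong ⊖_ }
    ; comm = zipWith-comm +-comm }

  ⊕-abelianGroup : ℕ → AbelianGroup 0ℓ 0ℓ
  ⊕-abelianGroup n = record { isAbelianGroup = ⊕-isAbelianGroup n }

  module ⊕ {n : ℕ} where
    open IsAbelianGroup (⊕-isAbelianGroup n) public
      using (assoc; comm; identityˡ; identityʳ; inverseˡ; inverseʳ)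
    open GroupProperties (AbelianGroup.group (⊕-abelianGroup n)) public
      using (inverseˡ-unique; x∙y⁻¹≈ε⇒x≈y)
    open import Algebra.Properties.CommutativeSemigroup (AbelianGroup.commutativeSemigroup (⊕-abelianGroup n)) public
      using (interchange)

  ⊙-distribˡ-⊕ : ∀ {n} c (u v : 𝕍 n) → c ⊙ (u ⊕ v) ≡ c ⊙ u ⊕ c ⊙ v
  ⊙-distribˡ-⊕ c []      []      = refl
  ⊙-distribˡ-⊕ c (a ∷ u) (b ∷ v) = cong₂ _∷_ (distribˡ c a b) (⊙-distribˡ-⊕ c u v)

  ⊙-distribʳ-+ : ∀ {n} c d (u : 𝕍 n) → (c +F d) ⊙ u ≡ c ⊙ u ⊕ d ⊙ u
  ⊙-distribʳ-+ c d []      = refl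
  ⊙-distribʳ-+ c d (a ∷ u) = cong₂ _∷_ (distribʳ a c d) (⊙-distribʳ-+ c d u)

  ⊙-assoc : ∀ {n} c d (u : 𝕍 n) → (c *F d) ⊙ u ≡ c ⊙ d ⊙ u
  ⊙-assoc c d []      = refl
  ⊙-assoc c d (a ∷ u) = cong₂ _∷_ (*-assoc c d a) (⊙-assoc c d u)

  ⊙-identityˡ : ∀ {n} (u : 𝕍 n) → 1F ⊙ u ≡ u
  ⊙-identityˡ []      = refl
  ⊙-identityˡ (a ∷ u) = cong₂ _∷_ (*-identityˡ a) (⊙-identityˡ u)

  ⊙-zeroˡ : ∀ {n} (u : 𝕍 n) → 0F ⊙ u ≡ 𝟎
  ⊙-zeroˡ []      = refl
  ⊙-zeroˡ (a ∷ u) = cong₂ _∷_ (zeroˡ a) (⊙-zeroˡ u)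

  ⊙-zeroʳ : ∀ {n} c → c ⊙ 𝟎 {n} ≡ 𝟎
  ⊙-zeroʳ {zero}  c = refl
  ⊙-zeroʳ {suc n} c = cong₂ _∷_ (zeroʳ c) (⊙-zeroʳ c)

  ⊙-inverseˡ : ∀ {n} c (u : 𝕍 n) → (-F c) ⊙ u ⊕ c ⊙ u ≡ 𝟎
  ⊙-inverseˡ c u = trans (sym (⊙-distribʳ-+ (-F c) c u)) (trans (cong (_⊙ u) (-‿inverseˡ c)) (⊙-zeroˡ u))

  ⊙-inverseʳ : ∀ {n} c (u : 𝕍 n) → c ⊙ u ⊕ (-F c) ⊙ u ≡ 𝟎
  ⊙-inverseʳ c u = trans (sym (⊙-distribʳ-+ c (-F c) u)) (trans (cong (_⊙ u) (-‿inverseʳ c)) (⊙-zeroˡ u))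

  ⊕-cancel : ∀ {n} (x : 𝕍 n) {y z} → y ⊕ z ≡ 𝟎 → x ⊕ y ⊕ z ≡ x
  ⊕-cancel x {y} {z} y⊕z≡𝟎 = trans (⊕.assoc x y z) (trans (cong (x ⊕_) y⊕z≡𝟎) (⊕.identityʳ x))

  ⊛-⊕ : ∀ {n k} (cs ds : Vec (Fin q) k) (vs : Vec (𝕍 n) k) → (cs ⊕ ds) ⊛ vs ≡ cs ⊛ vs ⊕ ds ⊛ vs
  ⊛-⊕ []       []       []       = sym (⊕.identityˡ 𝟎)
  ⊛-⊕ (c ∷ cs) (d ∷ ds) (v ∷ vs) = begin
    (c +F d) ⊙ v ⊕ (cs ⊕ ds) ⊛ vs           ≡⟨ cong₂ _⊕_ (⊙-distribʳ-+ c d v) (⊛-⊕ cs ds vs) ⟩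
    (c ⊙ v ⊕ d ⊙ v) ⊕ (cs ⊛ vs ⊕ ds ⊛ vs)   ≡⟨ ⊕.interchange _ _ _ _ ⟩
    (c ⊙ v ⊕ cs ⊛ vs) ⊕ (d ⊙ v ⊕ ds ⊛ vs)   ∎
    where open ≡-Reasoning

  ⊛-⊙ : ∀ {n k} c (cs : Vec (Fin q) k) (vs : Vec (𝕍 n) k) → (c ⊙ cs) ⊛ vs ≡ c ⊙ cs ⊛ vs
  ⊛-⊙ c []       []       = sym (⊙-zeroʳ c)
  ⊛-⊙ c (d ∷ cs) (v ∷ vs) = begin
    (c *F d) ⊙ v ⊕ (c ⊙ cs) ⊛ vs ≡⟨ cong₂ _⊕_ (⊙-assoc c d v) (⊛-⊙ c cs vs) ⟩
    c ⊙ d ⊙ v ⊕ c ⊙ cs ⊛ vs      ≡⟨ ⊙-distribˡ-⊕ c _ _ ⟨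
    c ⊙ (d ⊙ v ⊕ cs ⊛ vs)        ∎
    where open ≡-Reasoning

  𝟎-⊛ : ∀ {n k} (vs : Vec (𝕍 n) k) → 𝟎 ⊛ vs ≡ 𝟎
  𝟎-⊛ []       = refl
  𝟎-⊛ (v ∷ vs) = trans (cong₂ _⊕_ (⊙-zeroˡ v) (𝟎-⊛ vs)) (⊕.identityˡ 𝟎)

  ⊖-⊛ : ∀ {n k} (cs : Vec (Fin q) k) (vs : Vec (𝕍 n) k) → (⊖ cs) ⊛ vs ≡ ⊖ (cs ⊛ vs)
  ⊖-⊛ cs vs = ⊕.inverseˡ-unique _ _ (begin
    (⊖ cs) ⊛ vs ⊕ cs ⊛ vs ≡⟨ ⊛-⊕ (⊖ cs) cs vs ⟨
    (⊖ cs ⊕ cs) ⊛ vs      ≡⟨ cong (_⊛ vs) (⊕.inverseˡ cs) ⟩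
    𝟎 ⊛ vs                ≡⟨ 𝟎-⊛ vs ⟩
    𝟎                     ∎)
    where open ≡-Reasoning

  ⊛-injective : ∀ {n k} {vs : Vec (𝕍 n) k} → LinIndep 𝔽 vs → ∀ cs ds → cs ⊛ vs ≡ ds ⊛ vs → cs ≡ ds
  ⊛-injective {vs = vs} indep cs ds eq = ⊕.x∙y⁻¹≈ε⇒x≈y cs ds (indep (cs ⊕ ⊖ ds) (begin
    (cs ⊕ ⊖ ds) ⊛ vs          ≡⟨ ⊛-⊕ cs (⊖ ds) vs ⟩
    cs ⊛ vs ⊕ (⊖ ds) ⊛ vs     ≡⟨ cong₂ _⊕_ eq (⊖-⊛ ds vs) ⟩
    ds ⊛ vs ⊕ ⊖ (ds ⊛ vs)     ≡⟨ ⊕.inverseʳ _ ⟩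
    𝟎                         ∎))
    where open ≡-Reasoning

  dot-⊕ : ∀ {n} (r u v : 𝕍 n) → dot 𝔽 r (u ⊕ v) ≡ dot 𝔽 r u +F dot 𝔽 r v
  dot-⊕ []      []      []      = sym (+-identityˡ 0F)
  dot-⊕ (x ∷ r) (a ∷ u) (b ∷ v) =
    trans (cong₂ _+F_ (distribˡ x a b) (dot-⊕ r u v)) (+F-interchange _ _ _ _)

  dot-⊙ : ∀ {n} (r : 𝕍 n) c u → dot 𝔽 r (c ⊙ u) ≡ c *F dot 𝔽 r u
  dot-⊙ []      c []      = sym (zeroʳ c)
  dot-⊙ (x ∷ r) c (a ∷ u) =
    trans (cong₂ _+F_ (*F-leftComm x c a) (dot-⊙ r c u)) (sym (distribˡ c _ _))

  dot-𝟎 : ∀ {n} (r : 𝕍 n) → dot 𝔽 r 𝟎 ≡ 0F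
  dot-𝟎 []      = refl
  dot-𝟎 (x ∷ r) = trans (cong₂ _+F_ (zeroʳ x) (dot-𝟎 r)) (+-identityˡ 0F)

  infixr 7 _·_

  _·_ : ∀ {n} → Matrix 𝔽 n → 𝕍 n → 𝕍 n
  _·_ = apply 𝔽

  ·-𝟎 : ∀ {n} (T : Matrix 𝔽 n) → T · 𝟎 ≡ 𝟎
  ·-𝟎 T = rows T
    where
    rows : ∀ {n m} (R : Vec (𝕍 n) m) → map (λ r → dot 𝔽 r 𝟎) R ≡ 𝟎
    rows []      = refl
    rows (r ∷ R) = cong₂ _∷_ (dot-𝟎 r) (rows R)

  ·-⊕ : ∀ {n} (T : Matrix 𝔽 n) u v → T · (u ⊕ v) ≡ T · u ⊕ T · v
  ·-⊕ T u v = rows T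
    where
    rows : ∀ {m} (R : Vec (𝕍 _) m) →
           map (λ r → dot 𝔽 r (u ⊕ v)) R ≡ map (λ r → dot 𝔽 r u) R ⊕ map (λ r → dot 𝔽 r v) R
    rows []      = refl
    rows (r ∷ R) = cong₂ _∷_ (dot-⊕ r u v) (rows R)

  ·-⊙ : ∀ {n} (T : Matrix 𝔽 n) c u → T · (c ⊙ u) ≡ c ⊙ T · u
  ·-⊙ T c u = rows T
    where
    rows : ∀ {m} (R : Vec (𝕍 _) m) → map (λ r → dot 𝔽 r (c ⊙ u)) R ≡ c ⊙ map (λ r → dot 𝔽 r u) R
    rows []      = refl
    rows (r ∷ R) = cong₂ _∷_ (dot-⊙ r c u) (rows R)

  ·-⊛ : ∀ {n k} (T : Matrix 𝔽 n) cs (vs : Vec (𝕍 n) k) → T · (cs ⊛ vs) ≡ cs ⊛ map (T ·_) vs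
  ·-⊛ T []       []       = ·-𝟎 T
  ·-⊛ T (c ∷ cs) (v ∷ vs) = trans (·-⊕ T _ _) (cong₂ _⊕_ (·-⊙ T c v) (·-⊛ T cs vs))


  infix 4 _∈⟨_⟩ _∉⟨_⟩ _⊆⟨_⟩

  _∈⟨_⟩ : ∀ {n k} → 𝕍 n → Vec (𝕍 n) k → Set
  v ∈⟨ vs ⟩ = ∃ λ cs → cs ⊛ vs ≡ v

  _∉⟨_⟩ : ∀ {n k} → 𝕍 n → Vec (𝕍 n) k → Set
  v ∉⟨ vs ⟩ = ¬ v ∈⟨ vs ⟩

  _⊆⟨_⟩ : ∀ {n m k} → Vec (𝕍 n) m → Vec (𝕍 n) k → Set
  xs ⊆⟨ ws ⟩ = All (_∈⟨ ws ⟩) xs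

  module _ {n k} {vs : Vec (𝕍 n) k} where

    𝟎∈⟨⟩ : 𝟎 ∈⟨ vs ⟩
    𝟎∈⟨⟩ = 𝟎 , 𝟎-⊛ vs

    ⊕∈⟨⟩ : ∀ {x y} → x ∈⟨ vs ⟩ → y ∈⟨ vs ⟩ → x ⊕ y ∈⟨ vs ⟩
    ⊕∈⟨⟩ (cs , refl) (ds , refl) = cs ⊕ ds , ⊛-⊕ cs ds vs

    ⊙∈⟨⟩ : ∀ c {x} → x ∈⟨ vs ⟩ → c ⊙ x ∈⟨ vs ⟩
    ⊙∈⟨⟩ c (cs , refl) = c ⊙ cs , ⊛-⊙ c cs vs

    ⊖∈⟨⟩ : ∀ {x} → x ∈⟨ vs ⟩ → ⊖ x ∈⟨ vs ⟩
    ⊖∈⟨⟩ (cs , refl) = ⊖ cs , ⊖-⊛ cs vs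

    ⊙∈⟨⟩⁻¹ : ∀ {c x} → c ≢ 0F → c ⊙ x ∈⟨ vs ⟩ → x ∈⟨ vs ⟩
    ⊙∈⟨⟩⁻¹ {c} {x} c≢0 cx∈ with inverse c c≢0
    ... | d , cd≡1 = subst (_∈⟨ vs ⟩) d⊙c⊙x≡x (⊙∈⟨⟩ d cx∈)
      where
      d⊙c⊙x≡x : d ⊙ c ⊙ x ≡ x
      d⊙c⊙x≡x = trans (sym (⊙-assoc d c x)) (trans (cong (_⊙ x) (trans (*-comm d c) cd≡1)) (⊙-identityˡ x))

    ∈⟨∷⟩ : ∀ {v x} → x ∈⟨ vs ⟩ → x ∈⟨ v ∷ vs ⟩
    ∈⟨∷⟩ {v} (cs , refl) = 0F ∷ cs , trans (cong (_⊕ cs ⊛ vs) (⊙-zeroˡ v)) (⊕.identityˡ _)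

    head∈⟨∷⟩ : ∀ {v} → v ∈⟨ v ∷ vs ⟩
    head∈⟨∷⟩ {v} = 1F ∷ 𝟎 , trans (cong₂ _⊕_ (⊙-identityˡ v) (𝟎-⊛ vs)) (⊕.identityʳ v)

    ·-∈⟨⟩ : ∀ (T : Matrix 𝔽 n) {u} → u ∈⟨ vs ⟩ → T · u ∈⟨ map (T ·_) vs ⟩
    ·-∈⟨⟩ T (cs , refl) = cs , sym (·-⊛ T cs vs)

  ⊆⟨⟩-refl : ∀ {n k} (vs : Vec (𝕍 n) k) → vs ⊆⟨ vs ⟩
  ⊆⟨⟩-refl []       = []ᴬ
  ⊆⟨⟩-refl (v ∷ vs) = head∈⟨∷⟩ ∷ᴬ All.map ∈⟨∷⟩ (⊆⟨⟩-refl vs)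

  ∈⟨⟩-trans : ∀ {n m k} {xs : Vec (𝕍 n) m} {ws : Vec (𝕍 n) k} → xs ⊆⟨ ws ⟩ → ∀ {y} → y ∈⟨ xs ⟩ → y ∈⟨ ws ⟩
  ∈⟨⟩-trans []ᴬ         ([] , refl)       = 𝟎∈⟨⟩
  ∈⟨⟩-trans (x∈ ∷ᴬ xs⊆) (c ∷ cs , refl) = ⊕∈⟨⟩ (⊙∈⟨⟩ c x∈) (∈⟨⟩-trans xs⊆ (cs , refl))

  decode : ∀ n → Fin (q ^ n) → 𝕍 n
  decode zero    _ = []
  decode (suc n) i = proj₁ (remQuot {q} (q ^ n) i) ∷ decode n (proj₂ (remQuot {q} (q ^ n) i))

  decode-code : ∀ {n} (v : 𝕍 n) → decode n (code 𝔽 v) ≡ v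
  decode-code []               = refl
  decode-code {suc n} (x ∷ v) =
    trans (cong (λ (r , i) → r ∷ decode n i) (Fin.remQuot-combine {q} {q ^ n} x (code 𝔽 v)))
          (cong (x ∷_) (decode-code v))

  code-decode : ∀ n (i : Fin (q ^ n)) → code 𝔽 (decode n i) ≡ i
  code-decode zero    fzero = refl
  code-decode (suc n) i =
    trans (cong (combine (proj₁ (remQuot {q} (q ^ n) i))) (code-decode n (proj₂ (remQuot {q} (q ^ n) i))))
          (Fin.combine-remQuot {q} (q ^ n) i)

  code-injective : ∀ {n} {u v : 𝕍 n} → code 𝔽 u ≡ code 𝔽 v → u ≡ v
  code-injective {u = u} {v} eq = trans (sym (decode-code u)) (trans (cong (decode _) eq) (decode-code v))

  ∃? : ∀ {n} {P : 𝕍 n → Set} → (∀ v → Dec (P v)) → Dec (∃ P)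
  ∃? {n} {P} P? with Fin.any? (λ i → P? (decode n i))
  ... | yes (i , p) = yes (decode n i , p)
  ... | no ¬p       = no λ (v , p) → ¬p (code 𝔽 v , subst P (sym (decode-code v)) p)

  _∈⟨_⟩? : ∀ {n k} x (vs : Vec (𝕍 n) k) → Dec (x ∈⟨ vs ⟩)
  x ∈⟨ vs ⟩? = ∃? (λ cs → Vec.≡-dec Fin._≟_ (cs ⊛ vs) x)

  1<q : 1 < q
  1<q = distinct⇒1< 0F 1F 0≢1
    where
    distinct⇒1< : ∀ {m} (a b : Fin m) → a ≢ b → 1 < m
    distinct⇒1< {suc zero}    fzero fzero a≢b = ⊥-elim (a≢b refl)
    distinct⇒1< {suc (suc m)} _     _     _   = s≤s (s≤s z≤n)

  injective⇒≤ : ∀ {m k} (f : 𝕍 m → 𝕍 k) → (∀ {a b} → f a ≡ f b → a ≡ b) → m ≤ k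
  injective⇒≤ {m} {k} f f-inj with m ℕ.≤? k
  ... | yes m≤k = m≤k
  ... | no  m≰k with Fin.pigeonhole (ℕ.^-monoʳ-< q 1<q (ℕ.≰⇒> m≰k)) (λ i → code 𝔽 (f (decode m i)))
  ...   | i , j , i<j , eq = ⊥-elim (Fin.<⇒≢ i<j (begin
    i                          ≡⟨ code-decode m i ⟨
    code 𝔽 (decode m i)        ≡⟨ cong (code 𝔽) (f-inj (code-injective eq)) ⟩
    code 𝔽 (decode m j)        ≡⟨ code-decode m j ⟩
    j                          ∎))
    where open ≡-Reasoning

  -- Steinitz, by counting: coordinates in ws are injective on combinations of xs, so q ^ m ≤ q ^ k.
  independent⇒length≤ : ∀ {n m k} {xs : Vec (𝕍 n) m} {ws : Vec (𝕍 n) k} → LinIndep 𝔽 xs → xs ⊆⟨ ws ⟩ → m ≤ k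
  independent⇒length≤ {m = m} {k} {xs} {ws} indep xs⊆ = injective⇒≤ coords coords-injective
    where
    coords : Vec (Fin q) m → Vec (Fin q) k
    coords cs = proj₁ (∈⟨⟩-trans xs⊆ (cs , refl))

    coords-injective : ∀ {cs ds} → coords cs ≡ coords ds → cs ≡ ds
    coords-injective {cs} {ds} eq = ⊛-injective indep cs ds (begin
      cs ⊛ xs         ≡⟨ proj₂ (∈⟨⟩-trans xs⊆ (cs , refl)) ⟨
      coords cs ⊛ ws  ≡⟨ cong (_⊛ ws) eq ⟩
      coords ds ⊛ ws  ≡⟨ proj₂ (∈⟨⟩-trans xs⊆ (ds , refl)) ⟩
      ds ⊛ xs         ∎)
      where open ≡-Reasoning

  LinIndep-∷ : ∀ {n k} {y : 𝕍 n} {xs : Vec (𝕍 n) k} → LinIndep 𝔽 xs → y ∉⟨ xs ⟩ → LinIndep 𝔽 (y ∷ xs)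
  LinIndep-∷ {y = y} {xs} indep y∉ (c ∷ cs) eq with c Fin.≟ 0F
  ... | yes refl = cong (0F ∷_) (indep cs (trans (sym (⊕.identityˡ _)) (trans (cong (_⊕ cs ⊛ xs) (sym (⊙-zeroˡ y))) eq)))
  ... | no  c≢0  = ⊥-elim (y∉ (⊙∈⟨⟩⁻¹ c≢0 (subst (_∈⟨ xs ⟩) (sym (⊕.inverseˡ-unique _ _ eq)) (⊖∈⟨⟩ (cs , refl)))))

  -- The witnesses chosen here are used as data later on; keeping them abstract stops Agda
  -- from unfolding the underlying exhaustive searches during type checking.
  abstract
    independent-spans : ∀ {n k} {zs ws : Vec (𝕍 n) k} → LinIndep 𝔽 zs → zs ⊆⟨ ws ⟩ → ∀ {x} → x ∈⟨ ws ⟩ → x ∈⟨ zs ⟩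
    independent-spans {zs = zs} indep zs⊆ {x} x∈ with x ∈⟨ zs ⟩?
    ... | yes x∈zs = x∈zs
    ... | no  x∉zs = ⊥-elim (ℕ.1+n≰n (independent⇒length≤ (LinIndep-∷ indep x∉zs) (x∈ ∷ᴬ zs⊆)))

    ∃∈⟨⟩∉⟨⟩ : ∀ {n m k} {xs : Vec (𝕍 n) m} (ws : Vec (𝕍 n) k) → LinIndep 𝔽 xs → k < m → ∃ λ v → v ∈⟨ xs ⟩ × v ∉⟨ ws ⟩
    ∃∈⟨⟩∉⟨⟩ {xs = xs} ws indep k<m with ∃? (λ v → v ∈⟨ xs ⟩? ×-dec ¬? (v ∈⟨ ws ⟩?))
    ... | yes found = found
    ... | no  none  = ⊥-elim (ℕ.<⇒≱ k<m (independent⇒length≤ indep (All.map inside (⊆⟨⟩-refl xs))))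
      where
      inside : ∀ {x} → x ∈⟨ xs ⟩ → x ∈⟨ ws ⟩
      inside {x} x∈xs with x ∈⟨ ws ⟩?
      ... | yes x∈ws = x∈ws
      ... | no  x∉ws = ⊥-elim (none (x , x∈xs , x∉ws))

  infix 4 _∈ₛ_ _∈ₛ?_

  _∈ₛ_ : ∀ {n} → 𝕍 n → SubsetV 𝔽 n → Set
  _∈ₛ_ {n} = _∈V_ 𝔽 {n}

  _∈ₛ?_ : ∀ {n} (v : 𝕍 n) S → Dec (v ∈ₛ S)
  v ∈ₛ? S = code 𝔽 v Subset.∈? S

  ∈ₛ⇒⊆ : ∀ {n} {S S′ : SubsetV 𝔽 n} → (∀ v → v ∈ₛ S → v ∈ₛ S′) → S ⊆ S′
  ∈ₛ⇒⊆ {n} {S} {S′} S⊆S′ {i} i∈S =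
    subst (_∈ᶠ S′) (code-decode n i) (S⊆S′ (decode n i) (subst (_∈ᶠ S) (sym (code-decode n i)) i∈S))

  SubsetV-ext : ∀ {n} {S S′ : SubsetV 𝔽 n} → (∀ v → v ∈ₛ S → v ∈ₛ S′) → (∀ v → v ∈ₛ S′ → v ∈ₛ S) → S ≡ S′
  SubsetV-ext {n} S⊆S′ S′⊆S = Subset.⊆-antisym (∈ₛ⇒⊆ {n} S⊆S′) (∈ₛ⇒⊆ {n} S′⊆S)

  ⟦_⟧ : ∀ {n k} → Vec (𝕍 n) k → SubsetV 𝔽 n
  ⟦_⟧ {n} vs = tabulate (λ i → does (decode n i ∈⟨ vs ⟩?))

  module _ {n k} {vs : Vec (𝕍 n) k} where

    ∈⟦⟧⇒∈⟨⟩ : ∀ v → v ∈ₛ ⟦ vs ⟧ → v ∈⟨ vs ⟩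
    ∈⟦⟧⇒∈⟨⟩ v v∈ = from (decode n (code 𝔽 v) ∈⟨ vs ⟩?) (trans (sym (lookup∘tabulate _ (code 𝔽 v))) ([]=⇒lookup v∈))
      where
      from : (d : Dec (decode n (code 𝔽 v) ∈⟨ vs ⟩)) → does d ≡ true → v ∈⟨ vs ⟩
      from (yes p) _ = subst (_∈⟨ vs ⟩) (decode-code v) p

    ∈⟨⟩⇒∈⟦⟧ : ∀ {v} → v ∈⟨ vs ⟩ → v ∈ₛ ⟦ vs ⟧
    ∈⟨⟩⇒∈⟦⟧ {v} v∈ = lookup⇒[]= (code 𝔽 v) _ (trans (lookup∘tabulate _ (code 𝔽 v)) (to (decode n (code 𝔽 v) ∈⟨ vs ⟩?)))
      where
      to : (d : Dec (decode n (code 𝔽 v) ∈⟨ vs ⟩)) → does d ≡ true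
      to (yes _) = refl
      to (no ∉) = ⊥-elim (∉ (subst (_∈⟨ vs ⟩) (sym (decode-code v)) v∈))

    ⟦⟧-isSubspaceOfDim : LinIndep 𝔽 vs → IsSubspaceOfDim 𝔽 {n} ⟦ vs ⟧ k
    ⟦⟧-isSubspaceOfDim indep = vs , indep , λ v → ∈⟦⟧⇒∈⟨⟩ v , ∈⟨⟩⇒∈⟦⟧

  module _ {n k} {S : SubsetV 𝔽 n} (S-dim : IsSubspaceOfDim 𝔽 {n} S k) where

    ∈ₛ⇒∈⟨⟩ : ∀ v → v ∈ₛ S → v ∈⟨ proj₁ S-dim ⟩
    ∈ₛ⇒∈⟨⟩ v = proj₁ (proj₂ (proj₂ S-dim) v)

    ∈⟨⟩⇒∈ₛ : ∀ {v} → v ∈⟨ proj₁ S-dim ⟩ → v ∈ₛ S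
    ∈⟨⟩⇒∈ₛ {v} = proj₂ (proj₂ (proj₂ S-dim) v)

    subspace-∈⟨⟩ : ∀ {m} {xs : Vec (𝕍 n) m} → All (_∈ₛ S) xs → ∀ {v} → v ∈⟨ xs ⟩ → v ∈ₛ S
    subspace-∈⟨⟩ xs∈ v∈ = ∈⟨⟩⇒∈ₛ (∈⟨⟩-trans (All.map (∈ₛ⇒∈⟨⟩ _) xs∈) v∈)

    subspace-𝟎 : 𝟎 {n} ∈ₛ S
    subspace-𝟎 = subspace-∈⟨⟩ {xs = []} []ᴬ (𝟎∈⟨⟩ {vs = []})

  ≡⟦∷⟧ : ∀ {n k} {S : SubsetV 𝔽 n} → IsSubspaceOfDim 𝔽 {n} S (suc k) →
         ∀ {as : Vec (𝕍 n) k} → LinIndep 𝔽 as → (∀ {v} → v ∈⟨ as ⟩ → v ∈ₛ S) →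
         ∀ w → w ∈ₛ S → w ∉⟨ as ⟩ → S ≡ ⟦ w ∷ as ⟧
  ≡⟦∷⟧ S-dim {as} as-indep as⊆S w w∈S w∉as = SubsetV-ext
    (λ v v∈S → ∈⟨⟩⇒∈⟦⟧ (independent-spans (LinIndep-∷ as-indep w∉as) w∷as⊆ (∈ₛ⇒∈⟨⟩ S-dim v v∈S)))
    (λ v v∈ → ∈⟨⟩⇒∈ₛ S-dim (∈⟨⟩-trans w∷as⊆ (∈⟦⟧⇒∈⟨⟩ v v∈)))
    where
    w∷as⊆ : (w ∷ as) ⊆⟨ proj₁ S-dim ⟩
    w∷as⊆ = ∈ₛ⇒∈⟨⟩ S-dim w w∈S ∷ᴬ All.map (λ {a} a∈ → ∈ₛ⇒∈⟨⟩ S-dim a (as⊆S a∈)) (⊆⟨⟩-refl as)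

  IsBetween : ∀ {n k} → Vec (𝕍 n) k → Vec (𝕍 n) (2 + k) → SubsetV 𝔽 n → Set
  IsBetween {n} {k} as bs S =
    IsSubspaceOfDim 𝔽 {n} S (suc k) × (∀ {v} → v ∈⟨ as ⟩ → v ∈ₛ S) × (∀ v → v ∈ₛ S → v ∈⟨ bs ⟩)

  between-≡⟦∷⟧ : ∀ {n k} {as : Vec (𝕍 n) k} {bs : Vec (𝕍 n) (2 + k)} {S} → LinIndep 𝔽 as → IsBetween as bs S →
                 ∀ w → w ∈ₛ S → w ∉⟨ as ⟩ → S ≡ ⟦ w ∷ as ⟧
  between-≡⟦∷⟧ as-indep (S-dim , as⊆S , _) = ≡⟦∷⟧ S-dim as-indep as⊆S

  ⟦∷⟧-isBetween : ∀ {n k} {as : Vec (𝕍 n) k} {bs : Vec (𝕍 n) (2 + k)} → LinIndep 𝔽 as → as ⊆⟨ bs ⟩ →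
                  ∀ {w} → w ∈⟨ bs ⟩ → w ∉⟨ as ⟩ → IsBetween as bs ⟦ w ∷ as ⟧
  ⟦∷⟧-isBetween as-indep as⊆bs w∈bs w∉as =
      ⟦⟧-isSubspaceOfDim (LinIndep-∷ as-indep w∉as)
    , (λ v∈ → ∈⟨⟩⇒∈⟦⟧ (∈⟨∷⟩ v∈))
    , (λ v v∈ → ∈⟨⟩-trans (w∈bs ∷ᴬ as⊆bs) (∈⟦⟧⇒∈⟨⟩ v v∈))

  -- The subspaces between A = ⟨ as ⟩ and B = ⟨ bs ⟩ ⊇ A of codimension 2 are the q + 1 points
  -- of the projective line P(B/A): with b, s, as a basis of B, they are ⟨ s, A ⟩ and ⟨ b + t s, A ⟩.
  module Pencil {n k} {as : Vec (𝕍 n) k} (as-indep : LinIndep 𝔽 as)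
                {bs : Vec (𝕍 n) (2 + k)} (bs-indep : LinIndep 𝔽 bs) (as⊆bs : as ⊆⟨ bs ⟩) where

    private
      s-spec : ∃ λ s → s ∈⟨ bs ⟩ × s ∉⟨ as ⟩
      s-spec = ∃∈⟨⟩∉⟨⟩ as bs-indep (ℕ.m<n⇒m<1+n (ℕ.n<1+n k))

      s : 𝕍 n
      s = proj₁ s-spec

      b-spec : ∃ λ b → b ∈⟨ bs ⟩ × b ∉⟨ s ∷ as ⟩
      b-spec = ∃∈⟨⟩∉⟨⟩ (s ∷ as) bs-indep (ℕ.n<1+n (suc k))

      b : 𝕍 n
      b = proj₁ b-spec

      E : Vec (𝕍 n) (2 + k)
      E = b ∷ s ∷ as

      E-indep : LinIndep 𝔽 E
      E-indep = LinIndep-∷ (LinIndep-∷ as-indep (proj₂ (proj₂ s-spec))) (proj₂ (proj₂ b-spec))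

      E⊆bs : E ⊆⟨ bs ⟩
      E⊆bs = proj₁ (proj₂ b-spec) ∷ᴬ proj₁ (proj₂ s-spec) ∷ᴬ as⊆bs

    line : Fin (suc q) → 𝕍 n
    line fzero    = s
    line (fsuc t) = b ⊕ t ⊙ s

    pencil : Fin (suc q) → SubsetV 𝔽 n
    pencil x = ⟦ line x ∷ as ⟧

    private
      coords : Fin (suc q) → Fin q → Vec (Fin q) k → Vec (Fin q) (2 + k)
      coords fzero    c ds = 0F ∷ c ∷ ds
      coords (fsuc t) c ds = c ∷ c *F t ∷ ds

      coords-⊛ : ∀ x c ds → (c ∷ ds) ⊛ (line x ∷ as) ≡ coords x c ds ⊛ E
      coords-⊛ fzero    c ds = sym (trans (cong (_⊕ (c ⊙ s ⊕ ds ⊛ as)) (⊙-zeroˡ b)) (⊕.identityˡ _))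
      coords-⊛ (fsuc t) c ds = begin
        c ⊙ (b ⊕ t ⊙ s) ⊕ ds ⊛ as         ≡⟨ cong (_⊕ ds ⊛ as) (⊙-distribˡ-⊕ c b (t ⊙ s)) ⟩
        c ⊙ b ⊕ c ⊙ t ⊙ s ⊕ ds ⊛ as       ≡⟨ ⊕.assoc _ _ _ ⟩
        c ⊙ b ⊕ (c ⊙ t ⊙ s ⊕ ds ⊛ as)     ≡⟨ cong (λ z → c ⊙ b ⊕ (z ⊕ ds ⊛ as)) (⊙-assoc c t s) ⟨
        c ⊙ b ⊕ ((c *F t) ⊙ s ⊕ ds ⊛ as)  ∎
        where open ≡-Reasoning

      line-⊛ : ∀ x → coords x 1F 𝟎 ⊛ E ≡ line x
      line-⊛ x = trans (sym (coords-⊛ x 1F 𝟎)) (trans (cong₂ _⊕_ (⊙-identityˡ (line x)) (𝟎-⊛ as)) (⊕.identityʳ _))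

      coords-injective : ∀ x y c ds → coords y c ds ≡ coords x 1F 𝟎 → x ≡ y
      coords-injective fzero    fzero    c ds eq = refl
      coords-injective fzero    (fsuc t) c ds eq =
        ⊥-elim (0≢1 (trans (sym (zeroˡ t)) (trans (cong (_*F t) (sym (∷-injectiveˡ eq))) (∷-injectiveˡ (∷-injectiveʳ eq)))))
      coords-injective (fsuc t) fzero    c ds eq = ⊥-elim (0≢1 (∷-injectiveˡ eq))
      coords-injective (fsuc t) (fsuc u) c ds eq = cong fsuc (begin
        t        ≡⟨ *-identityˡ t ⟨
        1F *F t  ≡⟨ ∷-injectiveˡ (∷-injectiveʳ eq) ⟨
        c *F u   ≡⟨ cong (_*F u) (∷-injectiveˡ eq) ⟩
        1F *F u  ≡⟨ *-identityˡ u ⟩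
        u        ∎)
        where open ≡-Reasoning

      line∉⟨as⟩ : ∀ x → line x ∉⟨ as ⟩
      line∉⟨as⟩ fzero        = proj₂ (proj₂ s-spec)
      line∉⟨as⟩ x@(fsuc _) (ds , eq) = 0≢1 (cong head (⊛-injective E-indep (coords fzero 0F ds) (coords x 1F 𝟎) (begin
        coords fzero 0F ds ⊛ E        ≡⟨ coords-⊛ fzero 0F ds ⟨
        0F ⊙ s ⊕ ds ⊛ as              ≡⟨ cong (_⊕ ds ⊛ as) (⊙-zeroˡ s) ⟩
        𝟎 ⊕ ds ⊛ as                   ≡⟨ ⊕.identityˡ _ ⟩
        ds ⊛ as                       ≡⟨ eq ⟩
        line x                        ≡⟨ line-⊛ x ⟨
        coords x 1F 𝟎 ⊛ E             ∎)))
        where open ≡-Reasoning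

      ∈⟨E⟩⇒∈line : ∀ {v} → v ∈⟨ E ⟩ → ∃ λ x → v ∈⟨ line x ∷ as ⟩
      ∈⟨E⟩⇒∈line (α ∷ β ∷ ds , refl) with α Fin.≟ 0F
      ... | yes refl = fzero , β ∷ ds , coords-⊛ fzero β ds
      ... | no  α≢0  with inverse α α≢0
      ...   | α⁻¹ , αα⁻¹≡1 = fsuc (α⁻¹ *F β) , α ∷ ds ,
        trans (coords-⊛ (fsuc (α⁻¹ *F β)) α ds) (cong (λ γ → (α ∷ γ ∷ ds) ⊛ E) α*α⁻¹β≡β)
        where
        α*α⁻¹β≡β : α *F (α⁻¹ *F β) ≡ β
        α*α⁻¹β≡β = trans (sym (*-assoc α α⁻¹ β)) (trans (cong (_*F β) αα⁻¹≡1) (*-identityˡ β))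

    pencil-isBetween : ∀ x → IsBetween as bs (pencil x)
    pencil-isBetween x = ⟦∷⟧-isBetween as-indep as⊆bs (∈⟨⟩-trans E⊆bs (coords x 1F 𝟎 , line-⊛ x)) (line∉⟨as⟩ x)

    pencil-injective : ∀ {x y} → pencil x ≡ pencil y → x ≡ y
    pencil-injective {x} {y} eq with ∈⟦⟧⇒∈⟨⟩ {vs = line y ∷ as} (line x) (subst (line x ∈ₛ_) eq (∈⟨⟩⇒∈⟦⟧ head∈⟨∷⟩))
    ... | c ∷ ds , eq′ = coords-injective x y c ds
      (⊛-injective E-indep _ _ (trans (sym (coords-⊛ y c ds)) (trans eq′ (sym (line-⊛ x)))))

    isBetween⇒pencil : ∀ {S} → IsBetween as bs S → ∃ λ x → pencil x ≡ S
    isBetween⇒pencil {S} S-between@(S-dim , _ , S⊆bs)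
      with v , v∈ , v∉as ← ∃∈⟨⟩∉⟨⟩ as (proj₁ (proj₂ S-dim)) (ℕ.n<1+n k)
      with v∈S ← ∈⟨⟩⇒∈ₛ S-dim v∈
      with x , v∈line ← ∈⟨E⟩⇒∈line (independent-spans E-indep E⊆bs (S⊆bs v v∈S))
      = x , (begin
          pencil x    ≡⟨ between-≡⟦∷⟧ as-indep (pencil-isBetween x) v (∈⟨⟩⇒∈⟦⟧ v∈line) v∉as ⟩
          ⟦ v ∷ as ⟧  ≡⟨ between-≡⟦∷⟧ as-indep S-between v v∈S v∉as ⟨
          S           ∎)
      where open ≡-Reasoning

module Counting where

  private variable A B : Set

  ∑ : List A → (A → ℕ) → ℕ
  ∑ []ˡ       f = 0
  ∑ (x ∷ˡ xs) f = f x + ∑ xs f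

  𝟙 : ∀ {P : Set} → Dec P → ℕ
  𝟙 (yes _) = 1
  𝟙 (no _)  = 0

  count : ∀ {P : A → Set} → Decidable P → List A → ℕ
  count P? xs = ∑ xs (λ x → 𝟙 (P? x))

  length-filter : ∀ {P : A → Set} (P? : Decidable P) xs → List.length (List.filter P? xs) ≡ count P? xs
  length-filter P? []ˡ       = refl
  length-filter P? (x ∷ˡ xs) with P? x
  ... | yes _ = cong suc (length-filter P? xs)
  ... | no _  = length-filter P? xs

  ∑-0 : ∀ (xs : List A) → ∑ xs (λ _ → 0) ≡ 0
  ∑-0 []ˡ       = refl
  ∑-0 (x ∷ˡ xs) = ∑-0 xs

  ∑-cong : ∀ {f g : A → ℕ} → (∀ x → f x ≡ g x) → ∀ xs → ∑ xs f ≡ ∑ xs g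
  ∑-cong f≗g []ˡ       = refl
  ∑-cong f≗g (x ∷ˡ xs) = cong₂ _+_ (f≗g x) (∑-cong f≗g xs)

  ∑-mono : ∀ {f g : A → ℕ} → (∀ x → f x ≤ g x) → ∀ xs → ∑ xs f ≤ ∑ xs g
  ∑-mono f≤g []ˡ       = z≤n
  ∑-mono f≤g (x ∷ˡ xs) = ℕ.+-mono-≤ (f≤g x) (∑-mono f≤g xs)

  ∑-+ : ∀ (f g : A → ℕ) xs → ∑ xs (λ x → f x + g x) ≡ ∑ xs f + ∑ xs g
  ∑-+ f g []ˡ       = refl
  ∑-+ f g (x ∷ˡ xs) = trans (cong (f x + g x +_) (∑-+ f g xs)) (+-interchange (f x) (g x) _ _)

  ∑-* : ∀ c (f : A → ℕ) xs → ∑ xs (λ x → c * f x) ≡ c * ∑ xs f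
  ∑-* c f []ˡ       = sym (ℕ.*-zeroʳ c)
  ∑-* c f (x ∷ˡ xs) = trans (cong (c * f x +_) (∑-* c f xs)) (sym (ℕ.*-distribˡ-+ c (f x) _))

  ∑-++ : ∀ (f : A → ℕ) xs ys → ∑ (xs List.++ ys) f ≡ ∑ xs f + ∑ ys f
  ∑-++ f []ˡ       ys = refl
  ∑-++ f (x ∷ˡ xs) ys = trans (cong (f x +_) (∑-++ f xs ys)) (sym (ℕ.+-assoc (f x) _ _))

  ∑-swap : ∀ (f : A → B → ℕ) xs ys → ∑ xs (λ x → ∑ ys (f x)) ≡ ∑ ys (λ y → ∑ xs (λ x → f x y))
  ∑-swap f []ˡ       ys = sym (∑-0 ys)
  ∑-swap f (x ∷ˡ xs) ys = trans (cong (∑ ys (f x) +_) (∑-swap f xs ys)) (sym (∑-+ (f x) _ ys))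

  ∑-concatMap : ∀ (f : B → ℕ) (g : A → List B) xs → ∑ (List.concatMap g xs) f ≡ ∑ xs (λ x → ∑ (g x) f)
  ∑-concatMap f g []ˡ       = refl
  ∑-concatMap f g (x ∷ˡ xs) = trans (∑-++ f (g x) (List.concatMap g xs)) (cong (∑ (g x) f +_) (∑-concatMap f g xs))

  ∑-map : ∀ (f : B → ℕ) (g : A → B) xs → ∑ (List.map g xs) f ≡ ∑ xs (λ x → f (g x))
  ∑-map f g []ˡ       = refl
  ∑-map f g (x ∷ˡ xs) = cong (f (g x) +_) (∑-map f g xs)

  ∑-allVecs : ∀ (L : List A) k (f : Vec A (suc k) → ℕ) →
              ∑ (allVecs L (suc k)) f ≡ ∑ L (λ x → ∑ (allVecs L k) (λ R → f (x ∷ R)))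
  ∑-allVecs L k f = trans (∑-concatMap f _ L) (∑-cong (λ x → ∑-map f (x ∷_) (allVecs L k)) L)

  ∑-allVecs-insertAt : ∀ (L : List A) k (p : Fin (suc k)) (f : Vec A (suc k) → ℕ) →
                       ∑ (allVecs L (suc k)) f ≡ ∑ (allVecs L k) (λ R → ∑ L (λ x → f (insertAt R p x)))
  ∑-allVecs-insertAt L k fzero f =
    trans (∑-allVecs L k f) (∑-swap (λ x R → f (x ∷ R)) L (allVecs L k))
  ∑-allVecs-insertAt L (suc k) (fsuc p) f = begin
    ∑ (allVecs L (2 + k)) f                                                     ≡⟨ ∑-allVecs L (suc k) f ⟩
    ∑ L (λ y → ∑ (allVecs L (suc k)) (λ R → f (y ∷ R)))
      ≡⟨ ∑-cong (λ y → ∑-allVecs-insertAt L k p (λ R → f (y ∷ R))) L ⟩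
    ∑ L (λ y → ∑ (allVecs L k) (λ R → ∑ L (λ x → f (y ∷ insertAt R p x))))     ≡⟨ ∑-allVecs L k _ ⟨
    ∑ (allVecs L (suc k)) (λ R → ∑ L (λ x → f (insertAt R (fsuc p) x)))         ∎
    where open ≡-Reasoning

  module _ {A : Set} {P Q : A → Set} (P? : Decidable P) (Q? : Decidable Q) where

    count-cong : (∀ {x} → P x → Q x) → (∀ {x} → Q x → P x) → ∀ xs → count P? xs ≡ count Q? xs
    count-cong P⇒Q Q⇒P = ∑-cong 𝟙-cong
      where
      𝟙-cong : ∀ x → 𝟙 (P? x) ≡ 𝟙 (Q? x)
      𝟙-cong x with P? x | Q? x
      ... | yes _  | yes _  = refl
      ... | yes p  | no ¬q  = ⊥-elim (¬q (P⇒Q p))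
      ... | no ¬p  | yes q  = ⊥-elim (¬p (Q⇒P q))
      ... | no _   | no _   = refl

    count-mono : (∀ {x} → P x → Q x) → ∀ xs → count P? xs ≤ count Q? xs
    count-mono P⇒Q = ∑-mono 𝟙-mono
      where
      𝟙-mono : ∀ x → 𝟙 (P? x) ≤ 𝟙 (Q? x)
      𝟙-mono x with P? x | Q? x
      ... | yes _ | yes _ = ℕ.≤-refl
      ... | yes p | no ¬q = ⊥-elim (¬q (P⇒Q p))
      ... | no _  | _     = z≤n

  module _ {A : Set} {P : A → Set} (P? : Decidable P) where

    count-none : (∀ {x} → ¬ P x) → ∀ xs → count P? xs ≡ 0
    count-none ¬P []ˡ       = refl
    count-none ¬P (x ∷ˡ xs) with P? x
    ... | yes p = ⊥-elim (¬P p)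
    ... | no _  = count-none ¬P xs

    count≢0⇒∃ : ∀ xs → count P? xs ≢ 0 → ∃ λ x → x ∈ xs × P x
    count≢0⇒∃ []ˡ       ≢0 = ⊥-elim (≢0 refl)
    count≢0⇒∃ (x ∷ˡ xs) ≢0 with P? x
    ... | yes p = x , here refl , p
    ... | no _  with count≢0⇒∃ xs ≢0
    ...   | y , y∈ , p = y , there y∈ , p

    count≡0⇒¬ : ∀ xs → count P? xs ≡ 0 → ∀ {x} → x ∈ xs → ¬ P x
    count≡0⇒¬ (y ∷ˡ xs) ≡0 (here refl) p with P? y
    ... | no ¬p = ¬p p
    count≡0⇒¬ (y ∷ˡ xs) ≡0 (there x∈) p with P? y
    ... | no _ = count≡0⇒¬ xs ≡0 x∈ p

  module _ {A : Set} (_≟_ : DecidableEquality A) where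

    record IsEnumeration (L : List A) : Set where
      field counted-once : ∀ a → count (_≟ a) L ≡ 1

    count-singleton : ∀ {L} → IsEnumeration L → ∀ {P : A → Set} (P? : Decidable P) → ∃! _≡_ P → count P? L ≡ 1
    count-singleton {L} enum P? (a , Pa , unique) =
      trans (count-cong P? (_≟ a) (λ Px → sym (unique Px)) (λ where refl → Pa) L) (IsEnumeration.counted-once enum a)

    count-image : ∀ {L} → IsEnumeration L → ∀ {m} (g : Fin m → A) → (∀ {i j} → g i ≡ g j → i ≡ j) →
                  ∀ {P : A → Set} (P? : Decidable P) → (∀ {x} → P x → ∃ λ i → g i ≡ x) → (∀ i → P (g i)) →
                  count P? L ≡ m
    count-image {L} enum {zero} g g-inj P? P⇒img img⇒P = count-none P? (λ p → case proj₁ (P⇒img p) of λ ()) L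
    count-image {L} enum {suc m} g g-inj {P} P? P⇒img img⇒P = begin
      count P? L                                   ≡⟨ ∑-cong 𝟙-split L ⟩
      ∑ L (λ x → 𝟙 (x ≟ g fzero) + 𝟙 (Rest? x))   ≡⟨ ∑-+ _ _ L ⟩
      count (_≟ g fzero) L + count Rest? L         ≡⟨ cong₂ _+_ (IsEnumeration.counted-once enum (g fzero)) rest ⟩
      suc m                                        ∎
      where
      open ≡-Reasoning
      Rest : A → Set
      Rest x = ∃ λ i → g (fsuc i) ≡ x

      Rest? : Decidable Rest
      Rest? x = Fin.any? (λ i → g (fsuc i) ≟ x)

      rest : count Rest? L ≡ m
      rest = count-image enum (λ i → g (fsuc i)) (λ eq → Fin.suc-injective (g-inj eq)) Rest? (λ r → r) (λ i → i , refl)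

      𝟙-split : ∀ x → 𝟙 (P? x) ≡ 𝟙 (x ≟ g fzero) + 𝟙 (Rest? x)
      𝟙-split x with P? x | x ≟ g fzero | Rest? x
      ... | _     | yes refl | yes (i , eq) = ⊥-elim (Fin.0≢1+n (g-inj (sym eq)))
      ... | yes _ | yes _    | no _         = refl
      ... | yes _ | no _     | yes _        = refl
      ... | yes p | no x≢g₀  | no ¬rest with P⇒img p
      ...   | fzero  , eq = ⊥-elim (x≢g₀ (sym eq))
      ...   | fsuc i , eq = ⊥-elim (¬rest (i , eq))
      𝟙-split x | no ¬p | yes refl | _ = ⊥-elim (¬p (img⇒P fzero))
      𝟙-split x | no ¬p | no _ | yes (i , refl) = ⊥-elim (¬p (img⇒P (fsuc i)))
      𝟙-split x | no _  | no _ | no _ = refl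

  allVecs-isEnumeration : ∀ {_≟_ : DecidableEquality A} {L} → IsEnumeration _≟_ L →
                          ∀ k → IsEnumeration (Vec.≡-dec _≟_) (allVecs L k)
  allVecs-isEnumeration {_≟_ = _≟_} {L} enum k = record { counted-once = once k }
    where
    _≟ᵛ_ : ∀ {n} → DecidableEquality (Vec _ n)
    _≟ᵛ_ = Vec.≡-dec _≟_

    once : ∀ k (v : Vec _ k) → count (_≟ᵛ v) (allVecs L k) ≡ 1
    once zero    []       = refl
    once (suc k) (y ∷ v) = begin
      count (_≟ᵛ (y ∷ v)) (allVecs L (suc k))                      ≡⟨ ∑-allVecs L k _ ⟩
      ∑ L (λ x → count (λ u → (x ∷ u) ≟ᵛ (y ∷ v)) (allVecs L k))  ≡⟨ ∑-cong (λ x → heads x (x ≟ y)) L ⟩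
      count (_≟ y) L                                                ≡⟨ IsEnumeration.counted-once enum y ⟩
      1                                                             ∎
      where
      open ≡-Reasoning
      heads : ∀ x (d : Dec (x ≡ y)) → count (λ u → (x ∷ u) ≟ᵛ (y ∷ v)) (allVecs L k) ≡ 𝟙 d
      heads x (yes refl) = trans (count-cong _ (_≟ᵛ v) Vec.∷-injectiveʳ (cong (x ∷_)) (allVecs L k)) (once k v)
      heads x (no x≢y)   = count-none _ (λ eq → x≢y (Vec.∷-injectiveˡ eq)) (allVecs L k)

  -- Either P₀ holds on all of P₂ (so P₀ = P₁ = P₂), or P₁ is a singleton inside a
  -- (1 + q)-element P₂, or all three are empty.
  fibre-identity : ∀ q {P₀ P₁ P₂ : A → Set} (P₀? : Decidable P₀) (P₁? : Decidable P₁) (P₂? : Decidable P₂) →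
                   (∀ {y} → P₀ y → P₁ y) → (∀ {y} → P₁ y → P₂ y) → (∀ {x y} → P₀ x → P₂ y → P₀ y) →
                   ∀ L → (∀ {x} → P₂ x → count P₂? L ≡ 1 + q) → (∀ {x} → P₂ x → ¬ P₀ x → count P₁? L ≡ 1) →
                   (1 + q) * count P₁? L ≡ q * count P₀? L + count P₂? L
  fibre-identity q P₀? P₁? P₂? P₀⇒P₁ P₁⇒P₂ spread L full single
    with count P₀? L ℕ.≟ 0 | count P₂? L ℕ.≟ 0
  ... | no c₀≢0 | _
    with x , _ , p₀ ← count≢0⇒∃ P₀? L c₀≢0
    rewrite count-cong P₁? P₀? (λ p₁ → spread p₀ (P₁⇒P₂ p₁)) P₀⇒P₁ L
          | count-cong P₂? P₀? (spread p₀) (λ p₀′ → P₁⇒P₂ (P₀⇒P₁ p₀′)) L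
          = ℕ.+-comm (count P₀? L) _
  ... | yes c₀≡0 | no c₂≢0
    with x , x∈L , p₂ ← count≢0⇒∃ P₂? L c₂≢0
    rewrite c₀≡0 | single p₂ (count≡0⇒¬ P₀? L c₀≡0 x∈L) | full p₂
          = trans (ℕ.*-identityʳ (1 + q)) (cong (_+ (1 + q)) (sym (ℕ.*-zeroʳ q)))
  ... | yes c₀≡0 | yes c₂≡0
    rewrite c₀≡0 | c₂≡0 | ℕ.n≤0⇒n≡0 (subst (count P₁? L ≤_) c₂≡0 (count-mono P₁? P₂? P₁⇒P₂ L))
          = trans (ℕ.*-zeroʳ (1 + q)) (sym (cong (_+ 0) (ℕ.*-zeroʳ q)))

at-insertAt : ∀ {A : Set} {k} (d : A) (R : Vec A k) (p : Fin (suc k)) y → at d (insertAt R p y) (suc (toℕ p)) ≡ y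
at-insertAt d R       fzero    y = refl
at-insertAt d (x ∷ R) (fsuc p) y = at-insertAt d R p y

at-insertAt-≢ : ∀ {A : Set} {k} (d : A) (R : Vec A k) (p : Fin (suc k)) {j} → j ≢ suc (toℕ p) →
                ∀ y y′ → at d (insertAt R p y) j ≡ at d (insertAt R p y′) j
at-insertAt-≢ d R       fzero    {zero}        j≢ y y′ = refl
at-insertAt-≢ d R       fzero    {suc zero}    j≢ y y′ = ⊥-elim (j≢ refl)
at-insertAt-≢ d R       fzero    {suc (suc j)} j≢ y y′ = refl
at-insertAt-≢ d (x ∷ R) (fsuc p) {zero}        j≢ y y′ = refl
at-insertAt-≢ d (x ∷ R) (fsuc p) {suc zero}    j≢ y y′ = refl
at-insertAt-≢ d (x ∷ R) (fsuc p) {suc (suc j)} j≢ y y′ = at-insertAt-≢ d R p (j≢ ∘ cong suc) y y′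

Hessenberg-mono : ∀ {n} {m : Vec ℕ n} → IsHessenberg n m → ∀ {a b} → 1 ≤ a → a ≤ b → b ≤ n → m ⟨ a ⟩ ≤ m ⟨ b ⟩
Hessenberg-mono {m = m} H {b = zero}  1≤a a≤b b≤n = ⊥-elim (ℕ.1+n≰n (ℕ.≤-trans 1≤a a≤b))
Hessenberg-mono {m = m} H {b = suc b} 1≤a a≤b b≤n with ℕ.m≤n⇒m<n∨m≡n a≤b
... | inj₂ refl       = ℕ.≤-refl
... | inj₁ (s≤s a≤b′) =
  ℕ.≤-trans (Hessenberg-mono H 1≤a a≤b′ (ℕ.≤-trans (ℕ.n≤1+n b) b≤n)) (proj₂ H b (ℕ.≤-trans 1≤a a≤b′) b≤n)

infix 4 _≼_

_≼_ : ∀ {n} → Vec ℕ n → Vec ℕ n → Set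
_≼_ {n} m m′ = ∀ j → 1 ≤ j → j ≤ n → m ⟨ j ⟩ ≤ m′ ⟨ j ⟩

-- V_h is then constrained by H(m) only through V_(h-1) ⊆ V_h ⊆ V_(h+1)
IsFreeAt : ∀ {n} → Vec ℕ n → ℕ → Set
IsFreeAt {n} m h = (∀ j → 1 ≤ j → j ≤ n → m ⟨ j ⟩ ≢ h) × m ⟨ h ⟩ ≡ m ⟨ suc h ⟩

module Flags {q : ℕ} (𝔽 : FiniteField q) {n′ : ℕ} (T : Matrix 𝔽 (suc n′)) where
  open VectorSpace 𝔽
  open Counting

  n : ℕ
  n = suc n′

  infixl 9 _!_

  _!_ : Flag 𝔽 n → ℕ → SubsetV 𝔽 n
  F ! j = _⟪_⟫ 𝔽 {n} F j

  Complete : Flag 𝔽 n → Set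
  Complete = IsCompleteFlag 𝔽 {n}

  Hess : Vec ℕ n → Flag 𝔽 n → Set
  Hess m = InHess 𝔽 {n} m T

  subsets : List (SubsetV 𝔽 n)
  subsets = allVecs (true ∷ˡ false ∷ˡ []ˡ) (q ^ n)

  subsets-isEnumeration : IsEnumeration (Vec.≡-dec Bool._≟_) subsets
  subsets-isEnumeration = allVecs-isEnumeration (record { counted-once = λ { true → refl ; false → refl } }) (q ^ n)

  flag-mono : ∀ {F : Flag 𝔽 n} → Complete F → ∀ {a b} → 1 ≤ a → a ≤ b → b ≤ n → ∀ (v : 𝕍 n) → v ∈ₛ F ! a → v ∈ₛ F ! b
  flag-mono cF {b = zero}  1≤a a≤b b≤n v v∈ = ⊥-elim (ℕ.1+n≰n (ℕ.≤-trans 1≤a a≤b))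
  flag-mono cF {b = suc b} 1≤a a≤b b≤n v v∈ with ℕ.m≤n⇒m<n∨m≡n a≤b
  ... | inj₂ refl       = v∈
  ... | inj₁ (s≤s a≤b′) =
    proj₂ cF b (ℕ.≤-trans 1≤a a≤b′) b≤n (flag-mono cF 1≤a a≤b′ (ℕ.≤-trans (ℕ.n≤1+n b) b≤n) v v∈)

  Hess-mono : ∀ {m m′} → IsHessenberg n m → IsHessenberg n m′ → m ≼ m′ →
              ∀ {F : Flag 𝔽 n} → Hess m F → Hess m′ F
  Hess-mono Hm Hm′ m≤m′ (cF , TF⊆) = cF , λ j 1≤j j≤n v v∈ →
    flag-mono cF (ℕ.≤-trans 1≤j (proj₁ (proj₁ Hm j 1≤j j≤n))) (m≤m′ j 1≤j j≤n) (proj₂ (proj₁ Hm′ j 1≤j j≤n))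
      (T · v) (TF⊆ j 1≤j j≤n v v∈)

  HessAt : Vec ℕ n → Flag 𝔽 n → ℕ → Set
  HessAt m F j = ∀ v → v ∈ₛ F ! j → T · v ∈ₛ F ! (m ⟨ j ⟩)

  HessAt-cong : ∀ {m m′ F j} → m ⟨ j ⟩ ≡ m′ ⟨ j ⟩ → HessAt m F j → HessAt m′ F j
  HessAt-cong {F = F} mj≡m′j TF⊆ v v∈ = subst (λ k → T · v ∈ₛ F ! k) mj≡m′j (TF⊆ v v∈)

  Hess-except : ∀ {m m′} {F : Flag 𝔽 n} → Hess m′ F → (∀ j → 1 ≤ j → j ≤ n → m ⟨ j ⟩ ≢ m′ ⟨ j ⟩ → HessAt m F j) → Hess m F
  Hess-except {m} {m′} {F} (cF , TF⊆) differ = cF , λ j 1≤j j≤n → case m ⟨ j ⟩ ℕ.≟ m′ ⟨ j ⟩ of λ where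
    (yes mj≡m′j) → HessAt-cong {m′} {m} {F} {j} (sym mj≡m′j) (TF⊆ j 1≤j j≤n)
    (no  mj≢m′j) → differ j 1≤j j≤n mj≢m′j

  abstract
    ¬HessAt⇒∃ : ∀ {m F j} → ¬ HessAt m F j → ∃ λ v → v ∈ₛ F ! j × ¬ (T · v ∈ₛ F ! (m ⟨ j ⟩))
    ¬HessAt⇒∃ {m} {F} {j} ¬TF⊆ with ∃? (λ v → (v ∈ₛ? F ! j) ×-dec ¬? (T · v ∈ₛ? F ! (m ⟨ j ⟩)))
    ... | yes found = found
    ... | no  none  = ⊥-elim (¬TF⊆ λ v v∈ → decidable-stable (T · v ∈ₛ? _) (λ Tv∉ → none (v , v∈ , Tv∉)))

  record Basis (F : Flag 𝔽 n) (j : ℕ) : Set where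
    field
      vecs  : Vec (𝕍 n) j
      indep : LinIndep 𝔽 vecs
      spans : 1 ≤ j → IsSpanOf 𝔽 (F ! j) vecs

    ∈⇒∈⟨⟩ : 1 ≤ j → ∀ (v : 𝕍 n) → v ∈ₛ F ! j → v ∈⟨ vecs ⟩
    ∈⇒∈⟨⟩ 1≤j v = proj₁ (spans 1≤j v)

    ∈⟨⟩⇒∈ : 1 ≤ j → ∀ {v} → v ∈⟨ vecs ⟩ → v ∈ₛ F ! j
    ∈⟨⟩⇒∈ 1≤j {v} = proj₂ (spans 1≤j v)

  basis : ∀ {F : Flag 𝔽 n} → Complete F → ∀ {j} → j ≤ n → Basis F j
  basis cF {zero}  _   = record { vecs = [] ; indep = λ { [] _ → refl } ; spans = λ () }
  basis cF {suc j} j≤n with proj₁ cF (suc j) (s≤s z≤n) j≤n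
  ... | vs , indep , span = record { vecs = vs ; indep = indep ; spans = λ _ → span }

  -- F ! 0 is the empty set, but a basis of length 0 spans the zero subspace
  ∈⟨⟩-elim : ∀ {F : Flag 𝔽 n} {j} (B : Basis F j) (P : 𝕍 n → Set) → P 𝟎 → (1 ≤ j → ∀ (v : 𝕍 n) → v ∈ₛ F ! j → P v) →
             ∀ {v} → v ∈⟨ Basis.vecs B ⟩ → P v
  ∈⟨⟩-elim {j = zero}  record { vecs = [] } P P𝟎 P-F ([] , refl) = P𝟎
  ∈⟨⟩-elim {j = suc j} B                   P P𝟎 P-F v∈          = P-F (s≤s z≤n) _ (Basis.∈⟨⟩⇒∈ B (s≤s z≤n) v∈)

  module Fibre (R : Vec (SubsetV 𝔽 n) n′) (p : Fin n) (h<n : suc (toℕ p) < n) where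

    h : ℕ
    h = suc (toℕ p)

    flag : SubsetV 𝔽 n → Flag 𝔽 n
    flag y = insertAt R p y

    flag-h : ∀ y → flag y ! h ≡ y
    flag-h = at-insertAt _ R p

    flag-≢h : ∀ {j} → j ≢ h → ∀ x y → flag x ! j ≡ flag y ! j
    flag-≢h = at-insertAt-≢ _ R p

    HessAt-fibre : ∀ {m j} → j ≢ h → m ⟨ j ⟩ ≢ h → ∀ {x y} → HessAt m (flag x) j → HessAt m (flag y) j
    HessAt-fibre {m} {j} j≢h mj≢h {x} {y} Tx⊆ v v∈ =
      subst (T · v ∈ₛ_) (flag-≢h mj≢h x y) (Tx⊆ v (subst (v ∈ₛ_) (flag-≢h j≢h y x) v∈))

    HessAt-fibre-h : ∀ {m} → m ⟨ h ⟩ ≡ m ⟨ suc h ⟩ → m ⟨ h ⟩ ≢ h →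
                     ∀ {x y} → HessAt m (flag x) (suc h) → Complete (flag y) → HessAt m (flag y) h
    HessAt-fibre-h {m} mh≡mh+1 mh≢h {x} {y} Tx⊆ cy v v∈ =
      subst (T · v ∈ₛ_) (trans (cong (flag x !_) (sym mh≡mh+1)) (flag-≢h mh≢h x y))
        (Tx⊆ v (subst (v ∈ₛ_) (flag-≢h ℕ.1+n≢n y x) (proj₂ cy h (s≤s z≤n) h<n v∈)))

    Hess-fibre : ∀ {m} → IsFreeAt m h → ∀ {x y} → Hess m (flag x) → Complete (flag y) → Hess m (flag y)
    Hess-fibre {m} (h∉m , mh≡mh+1) {x} {y} (cx , Tx⊆) cy = cy , Ty⊆
      where
      Ty⊆ : ∀ j → 1 ≤ j → j ≤ n → HessAt m (flag y) j
      Ty⊆ j 1≤j j≤n with j ℕ.≟ h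
      ... | yes refl = HessAt-fibre-h {m} mh≡mh+1 (h∉m h 1≤j j≤n) (Tx⊆ (suc h) (s≤s z≤n) h<n) cy
      ... | no j≢h   = HessAt-fibre {m} j≢h (h∉m j 1≤j j≤n) (Tx⊆ j 1≤j j≤n)

    module Frame {x} (cx : Complete (flag x)) where

      private
        p<n : toℕ p < n
        p<n = ℕ.≤-trans (ℕ.n≤1+n h) h<n

        p≢h : toℕ p ≢ h
        p≢h = ℕ.<⇒≢ (ℕ.n<1+n (toℕ p))

        h+1≢h : suc h ≢ h
        h+1≢h = ℕ.1+n≢n

      A : Basis (flag x) (toℕ p)
      A = basis cx (ℕ.<⇒≤ p<n)

      B : Basis (flag x) (suc h)
      B = basis cx h<n

      as : Vec (𝕍 n) (toℕ p)
      as = Basis.vecs A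

      bs : Vec (𝕍 n) (suc h)
      bs = Basis.vecs B

      as⊆bs : as ⊆⟨ bs ⟩
      as⊆bs = All.map (∈⟨⟩-elim A (_∈⟨ bs ⟩) 𝟎∈⟨⟩ A⊆B) (⊆⟨⟩-refl as)
        where
        A⊆B : 1 ≤ toℕ p → ∀ v → v ∈ₛ flag x ! toℕ p → v ∈⟨ bs ⟩
        A⊆B 1≤p v v∈ = Basis.∈⇒∈⟨⟩ B (s≤s z≤n) v (flag-mono cx 1≤p (ℕ.m≤n⇒m≤1+n (ℕ.n≤1+n _)) h<n v v∈)

      open Pencil (Basis.indep A) (Basis.indep B) as⊆bs public

      complete⇒between : ∀ {y} → Complete (flag y) → IsBetween as bs y
      complete⇒between {y} cy = y-dim , as⊆y , y⊆bs
        where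
        y-dim : IsSubspaceOfDim 𝔽 {n} y h
        y-dim = subst (λ S → IsSubspaceOfDim 𝔽 S h) (flag-h y) (proj₁ cy h (s≤s z≤n) (ℕ.<⇒≤ h<n))

        as⊆y : ∀ {v} → v ∈⟨ as ⟩ → v ∈ₛ y
        as⊆y = ∈⟨⟩-elim A (_∈ₛ y) (subspace-𝟎 y-dim) λ 1≤p v v∈ →
          subst (v ∈ₛ_) (flag-h y) (proj₂ cy (toℕ p) 1≤p p<n (subst (v ∈ₛ_) (flag-≢h p≢h x y) v∈))

        y⊆bs : ∀ v → v ∈ₛ y → v ∈⟨ bs ⟩
        y⊆bs v v∈ = Basis.∈⇒∈⟨⟩ B (s≤s z≤n) v
          (subst (v ∈ₛ_) (flag-≢h h+1≢h y x) (proj₂ cy h (s≤s z≤n) h<n (subst (v ∈ₛ_) (sym (flag-h y)) v∈)))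

      between⇒complete : ∀ {y} → IsBetween as bs y → Complete (flag y)
      between⇒complete {y} (y-dim , as⊆y , y⊆bs) = dims , nested
        where
        dims : ∀ j → 1 ≤ j → j ≤ n → IsSubspaceOfDim 𝔽 (flag y ! j) j
        dims j 1≤j j≤n with j ℕ.≟ h
        ... | yes refl = subst (λ S → IsSubspaceOfDim 𝔽 S h) (sym (flag-h y)) y-dim
        ... | no j≢h   = subst (λ S → IsSubspaceOfDim 𝔽 S j) (flag-≢h j≢h x y) (proj₁ cx j 1≤j j≤n)

        nested : ∀ j → 1 ≤ j → j < n → flag y ! j ⊆ flag y ! suc j
        nested j 1≤j j<n with j ℕ.≟ h | suc j ℕ.≟ h
        ... | yes refl | _ = ∈ₛ⇒⊆ λ v v∈ →
          subst (v ∈ₛ_) (flag-≢h h+1≢h x y) (Basis.∈⟨⟩⇒∈ B (s≤s z≤n) (y⊆bs v (subst (v ∈ₛ_) (flag-h y) v∈)))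
        ... | no j≢h | yes refl = ∈ₛ⇒⊆ λ v v∈ →
          subst (v ∈ₛ_) (sym (flag-h y)) (as⊆y (Basis.∈⇒∈⟨⟩ A 1≤j v (subst (v ∈ₛ_) (flag-≢h j≢h y x) v∈)))
        ... | no j≢h | no j+1≢h = subst₂ _⊆_ (flag-≢h j≢h x y) (flag-≢h j+1≢h x y) (proj₂ cx j 1≤j j<n)

      count-between : ∀ {P : SubsetV 𝔽 n → Set} (P? : Decidable P) →
                      (∀ {y} → P y → IsBetween as bs y) → (∀ {y} → IsBetween as bs y → P y) → count P? subsets ≡ 1 + q
      count-between P? P⇒between between⇒P =
        count-image (Vec.≡-dec Bool._≟_) subsets-isEnumeration pencil pencil-injective P?
          (λ Py → isBetween⇒pencil (P⇒between Py)) (λ t → between⇒P (pencil-isBetween t))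

    fibre-identityᴴ : ∀ {m₀ m₁ m₂} → IsHessenberg n m₀ → IsHessenberg n m₁ → IsHessenberg n m₂ →
                      m₀ ≼ m₁ → m₁ ≼ m₂ →
                      IsFreeAt m₀ h → IsFreeAt m₂ h →
                      (∀ {x} → Hess m₂ (flag x) → ¬ Hess m₀ (flag x) → ∃! _≡_ (λ y → Hess m₁ (flag y))) →
                      (dec : ∀ m → Decidable (Hess m)) →
                      (1 + q) * count (dec m₁ ∘ flag) subsets
                        ≡ q * count (dec m₀ ∘ flag) subsets + count (dec m₂ ∘ flag) subsets
    fibre-identityᴴ {m₀} {m₁} {m₂} H₀ H₁ H₂ m₀≤m₁ m₁≤m₂ free₀ free₂ unique dec =
      fibre-identity q (dec m₀ ∘ flag) (dec m₁ ∘ flag) (dec m₂ ∘ flag) (Hess-mono H₀ H₁ m₀≤m₁) (Hess-mono H₁ H₂ m₁≤m₂)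
        (λ hess₀ hess₂ → Hess-fibre free₀ hess₀ (proj₁ hess₂)) subsets full single
      where
      full : ∀ {x} → Hess m₂ (flag x) → count (dec m₂ ∘ flag) subsets ≡ 1 + q
      full hess₂@(cx , _) = Frame.count-between cx (dec m₂ ∘ flag)
        (λ hess₂′ → Frame.complete⇒between cx (proj₁ hess₂′))
        (λ between → Hess-fibre free₂ hess₂ (Frame.between⇒complete cx between))

      single : ∀ {x} → Hess m₂ (flag x) → ¬ Hess m₀ (flag x) → count (dec m₁ ∘ flag) subsets ≡ 1
      single hess₂ ¬hess₀ = count-singleton (Vec.≡-dec Bool._≟_) subsets-isEnumeration (dec m₁ ∘ flag) (unique hess₂ ¬hess₀)

  hessCount-by-fibres : ∀ (p : Fin n) m (dec : Decidable (Hess m)) →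
                        hessCount 𝔽 m T dec ≡ ∑ (allVecs subsets n′) (λ R → count (λ y → dec (insertAt R p y)) subsets)
  hessCount-by-fibres p m dec = trans (length-filter dec (allFlags 𝔽 n)) (∑-allVecs-insertAt subsets n′ p (λ F → 𝟙 (dec F)))

  fibrewise⇒identity : ∀ (p : Fin n) {m₀ m₁ m₂} (dec : ∀ m → Decidable (Hess m)) →
    (∀ R → (1 + q) * count (λ y → dec m₁ (insertAt R p y)) subsets
             ≡ q * count (λ y → dec m₀ (insertAt R p y)) subsets + count (λ y → dec m₂ (insertAt R p y)) subsets) →
    (1 + q) * hessCount 𝔽 m₁ T (dec m₁) ≡ q * hessCount 𝔽 m₀ T (dec m₀) + hessCount 𝔽 m₂ T (dec m₂)
  fibrewise⇒identity p {m₀} {m₁} {m₂} dec fibrewise = begin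
    (1 + q) * hessCount 𝔽 m₁ T (dec m₁)                    ≡⟨ cong ((1 + q) *_) (hessCount-by-fibres p m₁ (dec m₁)) ⟩
    (1 + q) * ∑ Rs (c m₁)                                  ≡⟨ ∑-* (1 + q) (c m₁) Rs ⟨
    ∑ Rs (λ R → (1 + q) * c m₁ R)                          ≡⟨ ∑-cong fibrewise Rs ⟩
    ∑ Rs (λ R → q * c m₀ R + c m₂ R)                       ≡⟨ ∑-+ _ (c m₂) Rs ⟩
    ∑ Rs (λ R → q * c m₀ R) + ∑ Rs (c m₂)                  ≡⟨ cong (_+ ∑ Rs (c m₂)) (∑-* q (c m₀) Rs) ⟩
    q * ∑ Rs (c m₀) + ∑ Rs (c m₂)                          ≡⟨ cong₂ (λ a b → q * a + b) (hessCount-by-fibres p m₀ (dec m₀))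
                                                                                          (hessCount-by-fibres p m₂ (dec m₂)) ⟨
    q * hessCount 𝔽 m₀ T (dec m₀) + hessCount 𝔽 m₂ T (dec m₂) ∎
    where
    open ≡-Reasoning
    Rs : List (Vec (SubsetV 𝔽 n) n′)
    Rs = allVecs subsets n′

    c : Vec ℕ n → Vec (SubsetV 𝔽 n) n′ → ℕ
    c m R = count (λ y → dec m (insertAt R p y)) subsets

-- Condition (1) with h = m₁(i), in the fibre over the flag with V_h removed
module Case₁ {q : ℕ} (𝔽 : FiniteField q) {n′ : ℕ} (T : Matrix 𝔽 (suc n′))
             (R : Vec (SubsetV 𝔽 (suc n′)) n′) (p : Fin (suc n′)) (h<n : suc (toℕ p) < suc n′)
             {m₀ m₁ m₂ : Vec ℕ (suc n′)} (H₁ : IsHessenberg (suc n′) m₁) (i′ : ℕ) (i<h : suc i′ < suc (toℕ p))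
             (m₁i≡h : m₁ ⟨ suc i′ ⟩ ≡ suc (toℕ p)) (m₀i≡h-1 : m₀ ⟨ suc i′ ⟩ ≡ toℕ p)
             (m₂i≡h+1 : m₂ ⟨ suc i′ ⟩ ≡ suc (suc (toℕ p))) (m₁i-1<h : m₁ ⟨ i′ ⟩ < suc (toℕ p))
             (same : ∀ j → 1 ≤ j → j ≤ suc n′ → j ≢ suc i′ → m₀ ⟨ j ⟩ ≡ m₁ ⟨ j ⟩ × m₂ ⟨ j ⟩ ≡ m₁ ⟨ j ⟩)
             (h∉m₁ : ∀ j → 1 ≤ j → j ≤ suc n′ → j ≢ suc i′ → m₁ ⟨ j ⟩ ≢ suc (toℕ p))
             (m₁h≡m₁h+1 : m₁ ⟨ suc (toℕ p) ⟩ ≡ m₁ ⟨ suc (suc (toℕ p)) ⟩) where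

  open VectorSpace 𝔽
  open Flags 𝔽 T
  open Fibre R p h<n

  i : ℕ
  i = suc i′

  private
    1≤i : 1 ≤ i
    1≤i = s≤s z≤n

    i≤n : i ≤ n
    i≤n = ℕ.≤-trans (ℕ.<⇒≤ i<h) (ℕ.<⇒≤ h<n)

    i′≤n : i′ ≤ n
    i′≤n = ℕ.≤-trans (ℕ.n≤1+n i′) i≤n

    1≤p : 1 ≤ toℕ p
    1≤p = ℕ.≤-pred (ℕ.≤-trans (s≤s 1≤i) i<h)

    p≤n : toℕ p ≤ n
    p≤n = ℕ.≤-trans (ℕ.n≤1+n (toℕ p)) (ℕ.<⇒≤ h<n)

    i≢h : i ≢ h
    i≢h = ℕ.<⇒≢ i<h

    h+1≢i : suc h ≢ i
    h+1≢i h+1≡i = ℕ.<⇒≢ (ℕ.m<n⇒m<1+n i<h) (sym h+1≡i)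

    i′≢i : i′ ≢ i
    i′≢i = ℕ.<⇒≢ (ℕ.n<1+n i′)

    m₁h≢h : m₁ ⟨ h ⟩ ≢ h
    m₁h≢h m₁h≡h = ℕ.1+n≰n (subst (suc h ≤_) (trans (sym m₁h≡m₁h+1) m₁h≡h) (proj₁ (proj₁ H₁ (suc h) (s≤s z≤n) h<n)))

  module _ {x} (hess₂ : Hess m₂ (flag x)) (¬hess₀ : ¬ Hess m₀ (flag x)) where

    private
      cx : Complete (flag x)
      cx = proj₁ hess₂

      Tx⊆ : ∀ j → 1 ≤ j → j ≤ n → j ≢ i → HessAt m₁ (flag x) j
      Tx⊆ j 1≤j j≤n j≢i = HessAt-cong {m₂} {m₁} {flag x} {j} (proj₂ (same j 1≤j j≤n j≢i)) (proj₂ hess₂ j 1≤j j≤n)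

    open Frame cx

    ¬HessAt₀ᵢ : ¬ HessAt m₀ (flag x) i
    ¬HessAt₀ᵢ Tᵢ⊆ = ¬hess₀ (Hess-except hess₂ λ j 1≤j j≤n m₀j≢m₂j → case j ℕ.≟ i of λ where
      (yes refl) → Tᵢ⊆
      (no j≢i)   → ⊥-elim (m₀j≢m₂j (trans (proj₁ (same j 1≤j j≤n j≢i)) (sym (proj₂ (same j 1≤j j≤n j≢i))))))

    private
      violation : ∃ λ v → v ∈ₛ flag x ! i × ¬ (T · v ∈ₛ flag x ! toℕ p)
      violation = subst (λ l → ∃ λ v → v ∈ₛ flag x ! i × ¬ (T · v ∈ₛ flag x ! l)) m₀i≡h-1
                    (¬HessAt⇒∃ {m₀} {flag x} {i} ¬HessAt₀ᵢ)

      v : 𝕍 n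
      v = proj₁ violation

      v∈Fᵢ : v ∈ₛ flag x ! i
      v∈Fᵢ = proj₁ (proj₂ violation)

      Tv∉Fₕ₋₁ : ¬ (T · v ∈ₛ flag x ! toℕ p)
      Tv∉Fₕ₋₁ = proj₂ (proj₂ violation)

      w : 𝕍 n
      w = T · v

      w∈⟨bs⟩ : w ∈⟨ bs ⟩
      w∈⟨bs⟩ = Basis.∈⇒∈⟨⟩ B (s≤s z≤n) w (subst (λ k → w ∈ₛ flag x ! k) m₂i≡h+1 (proj₂ hess₂ i 1≤i i≤n v v∈Fᵢ))

      w∉⟨as⟩ : w ∉⟨ as ⟩
      w∉⟨as⟩ w∈ = Tv∉Fₕ₋₁ (Basis.∈⟨⟩⇒∈ A 1≤p w∈)

    -- V_i = ⟨ v, V_(i-1) ⟩ with T V_(i-1) ⊆ V_(h-1), so V_h ⊇ T V_i forces V_h = ⟨ T v, V_(h-1) ⟩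
    K : SubsetV 𝔽 n
    K = ⟦ w ∷ as ⟧

    K-isBetween : IsBetween as bs K
    K-isBetween = ⟦∷⟧-isBetween (Basis.indep A) as⊆bs w∈⟨bs⟩ w∉⟨as⟩

    Hess₁⇒≡K : ∀ {y} → Hess m₁ (flag y) → K ≡ y
    Hess₁⇒≡K {y} (cy , Ty⊆) = sym (between-≡⟦∷⟧ (Basis.indep A) (complete⇒between cy) w w∈y w∉⟨as⟩)
      where
      w∈y : w ∈ₛ y
      w∈y = subst (w ∈ₛ_) (trans (cong (flag y !_) m₁i≡h) (flag-h y))
              (Ty⊆ i 1≤i i≤n v (subst (v ∈ₛ_) (flag-≢h i≢h x y) v∈Fᵢ))

    private
      C : Basis (flag x) i′
      C = basis cx i′≤n

      cs : Vec (𝕍 n) i′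
      cs = Basis.vecs C

      Bᵢ : Basis (flag x) i
      Bᵢ = basis cx i≤n

      T⟨cs⟩⊆Fₕ₋₁ : ∀ {u} → u ∈⟨ cs ⟩ → T · u ∈ₛ flag x ! toℕ p
      T⟨cs⟩⊆Fₕ₋₁ = ∈⟨⟩-elim C (λ u → T · u ∈ₛ flag x ! toℕ p)
        (subst (_∈ₛ flag x ! toℕ p) (sym (·-𝟎 T)) (subspace-𝟎 (proj₁ cx (toℕ p) 1≤p p≤n)))
        λ 1≤i′ u u∈ → flag-mono cx (ℕ.≤-trans 1≤i′ (proj₁ (proj₁ H₁ i′ 1≤i′ i′≤n))) (ℕ.≤-pred m₁i-1<h) p≤n (T · u)
                        (Tx⊆ i′ 1≤i′ i′≤n i′≢i u u∈)

      v∉⟨cs⟩ : v ∉⟨ cs ⟩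
      v∉⟨cs⟩ v∈ = Tv∉Fₕ₋₁ (T⟨cs⟩⊆Fₕ₋₁ v∈)

      Fᵢ⊆⟨v∷cs⟩ : ∀ u → u ∈ₛ flag x ! i → u ∈⟨ v ∷ cs ⟩
      Fᵢ⊆⟨v∷cs⟩ u u∈ = independent-spans (LinIndep-∷ (Basis.indep C) v∉⟨cs⟩) v∷cs⊆ (Basis.∈⇒∈⟨⟩ Bᵢ 1≤i u u∈)
        where
        v∷cs⊆ : (v ∷ cs) ⊆⟨ Basis.vecs Bᵢ ⟩
        v∷cs⊆ = Basis.∈⇒∈⟨⟩ Bᵢ 1≤i v v∈Fᵢ ∷ᴬ All.map
          (∈⟨⟩-elim C (_∈⟨ Basis.vecs Bᵢ ⟩) 𝟎∈⟨⟩ λ 1≤i′ u u∈ →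
            Basis.∈⇒∈⟨⟩ Bᵢ 1≤i u (flag-mono cx 1≤i′ (ℕ.n≤1+n i′) i≤n u u∈))
          (⊆⟨⟩-refl cs)

      T⟨v∷cs⟩⊆⟨w∷as⟩ : ∀ {u} → u ∈⟨ v ∷ cs ⟩ → T · u ∈⟨ w ∷ as ⟩
      T⟨v∷cs⟩⊆⟨w∷as⟩ (c ∷ ds , refl) =
        subst (_∈⟨ w ∷ as ⟩) (sym (trans (·-⊕ T _ _) (cong (_⊕ T · (ds ⊛ cs)) (·-⊙ T c v))))
          (⊕∈⟨⟩ (⊙∈⟨⟩ c head∈⟨∷⟩) (∈⟨∷⟩ (Basis.∈⇒∈⟨⟩ A 1≤p _ (T⟨cs⟩⊆Fₕ₋₁ (ds , refl)))))

    Hess₁-K : Hess m₁ (flag K)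
    Hess₁-K = cK , TK⊆
      where
      cK : Complete (flag K)
      cK = between⇒complete K-isBetween

      TK⊆ : ∀ j → 1 ≤ j → j ≤ n → HessAt m₁ (flag K) j
      TK⊆ j 1≤j j≤n with j ℕ.≟ i | j ℕ.≟ h
      ... | yes refl | _ = λ u u∈ → subst (λ k → T · u ∈ₛ flag K ! k) (sym m₁i≡h) (subst (T · u ∈ₛ_) (sym (flag-h K))
                             (∈⟨⟩⇒∈⟦⟧ (T⟨v∷cs⟩⊆⟨w∷as⟩ (Fᵢ⊆⟨v∷cs⟩ u (subst (u ∈ₛ_) (flag-≢h i≢h K x) u∈)))))
      ... | no j≢i | yes refl = HessAt-fibre-h {m₁} m₁h≡m₁h+1 m₁h≢h (Tx⊆ (suc h) (s≤s z≤n) h<n h+1≢i) cK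
      ... | no j≢i | no j≢h = HessAt-fibre {m₁} j≢h (h∉m₁ j 1≤j j≤n j≢i) (Tx⊆ j 1≤j j≤n j≢i)

  Hess₁-unique : ∀ {x} → Hess m₂ (flag x) → ¬ Hess m₀ (flag x) → ∃! _≡_ (λ y → Hess m₁ (flag y))
  Hess₁-unique hess₂ ¬hess₀ = K hess₂ ¬hess₀ , Hess₁-K hess₂ ¬hess₀ , Hess₁⇒≡K hess₂ ¬hess₀

-- Condition (2) with h = i and k = m₁(i), in the fibre over the flag with V_h removed
module Case₂ {q : ℕ} (𝔽 : FiniteField q) {n′ : ℕ} (T : Matrix 𝔽 (suc n′))
             (R : Vec (SubsetV 𝔽 (suc n′)) n′) (p : Fin (suc n′)) (h<n : suc (toℕ p) < suc n′)
             {m₀ m₁ m₂ : Vec ℕ (suc n′)} (H₁ : IsHessenberg (suc n′) m₁) (k : ℕ) (h<k : suc (toℕ p) < k) (k<n : k < suc n′)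
             (m₁h≡k : m₁ ⟨ suc (toℕ p) ⟩ ≡ k) (m₀h≡k : m₀ ⟨ suc (toℕ p) ⟩ ≡ k)
             (m₀h+1≡k : m₀ ⟨ suc (suc (toℕ p)) ⟩ ≡ k) (m₂h+1≡m₁h+1 : m₂ ⟨ suc (suc (toℕ p)) ⟩ ≡ m₁ ⟨ suc (suc (toℕ p)) ⟩)
             (m₁h+1≡k+1 : m₁ ⟨ suc (suc (toℕ p)) ⟩ ≡ suc k)
             (same : ∀ j → 1 ≤ j → j ≤ suc n′ → j ≢ suc (toℕ p) → j ≢ suc (suc (toℕ p)) →
                     m₀ ⟨ j ⟩ ≡ m₁ ⟨ j ⟩ × m₂ ⟨ j ⟩ ≡ m₁ ⟨ j ⟩)
             (h∉m₁ : ∀ j → 1 ≤ j → j ≤ suc n′ → m₁ ⟨ j ⟩ ≢ suc (toℕ p)) where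

  open FiniteField 𝔽 using (-F_)
  open VectorSpace 𝔽
  open Flags 𝔽 T
  open Fibre R p h<n

  private
    1≤h : 1 ≤ h
    1≤h = s≤s z≤n

    1≤k : 1 ≤ k
    1≤k = ℕ.≤-trans (s≤s z≤n) h<k

    k≤n : k ≤ n
    k≤n = ℕ.<⇒≤ k<n

    p≤n : toℕ p ≤ n
    p≤n = ℕ.≤-trans (ℕ.n≤1+n (toℕ p)) (ℕ.<⇒≤ h<n)

    k≢h : k ≢ h
    k≢h k≡h = ℕ.<⇒≢ h<k (sym k≡h)

    p≢h : toℕ p ≢ h
    p≢h = ℕ.<⇒≢ (ℕ.n<1+n (toℕ p))

    h+1≢h : suc h ≢ h
    h+1≢h = ℕ.1+n≢n

  module _ {x} (hess₂ : Hess m₂ (flag x)) (¬hess₀ : ¬ Hess m₀ (flag x)) where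

    private
      cx : Complete (flag x)
      cx = proj₁ hess₂

      Tx⊆ : ∀ j → 1 ≤ j → j ≤ n → j ≢ h → HessAt m₁ (flag x) j
      Tx⊆ j 1≤j j≤n j≢h with j ℕ.≟ suc h
      ... | yes refl  = HessAt-cong {m₂} {m₁} {flag x} {j} m₂h+1≡m₁h+1 (proj₂ hess₂ j 1≤j j≤n)
      ... | no j≢h+1 = HessAt-cong {m₂} {m₁} {flag x} {j} (proj₂ (same j 1≤j j≤n j≢h j≢h+1)) (proj₂ hess₂ j 1≤j j≤n)

    open Frame cx

    -- V_h ⊆ V_(h+1), and m₀ sends both to k
    ¬HessAt₀ₕ₊₁ : ¬ HessAt m₀ (flag x) (suc h)
    ¬HessAt₀ₕ₊₁ Tₕ₊₁⊆ = ¬hess₀ (Hess-except hess₂ Tⱼ⊆)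
      where
      Tⱼ⊆ : ∀ j → 1 ≤ j → j ≤ n → m₀ ⟨ j ⟩ ≢ m₂ ⟨ j ⟩ → HessAt m₀ (flag x) j
      Tⱼ⊆ j 1≤j j≤n m₀j≢m₂j with j ℕ.≟ h | j ℕ.≟ suc h
      ... | yes refl | _ = λ u u∈ → subst (λ l → T · u ∈ₛ flag x ! l) (trans m₀h+1≡k (sym m₀h≡k))
                                      (Tₕ₊₁⊆ u (proj₂ cx h 1≤h h<n u∈))
      ... | _ | yes refl = Tₕ₊₁⊆
      ... | no j≢h | no j≢h+1 =
        ⊥-elim (m₀j≢m₂j (trans (proj₁ (same j 1≤j j≤n j≢h j≢h+1)) (sym (proj₂ (same j 1≤j j≤n j≢h j≢h+1)))))

    private
      violation : ∃ λ b → b ∈ₛ flag x ! suc h × ¬ (T · b ∈ₛ flag x ! k)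
      violation = subst (λ l → ∃ λ b → b ∈ₛ flag x ! suc h × ¬ (T · b ∈ₛ flag x ! l)) m₀h+1≡k
                    (¬HessAt⇒∃ {m₀} {flag x} {suc h} ¬HessAt₀ₕ₊₁)

      b : 𝕍 n
      b = proj₁ violation

      b∈Fₕ₊₁ : b ∈ₛ flag x ! suc h
      b∈Fₕ₊₁ = proj₁ (proj₂ violation)

      Tb∉Fₖ : ¬ (T · b ∈ₛ flag x ! k)
      Tb∉Fₖ = proj₂ (proj₂ violation)

      Fₖ-dim : IsSubspaceOfDim 𝔽 (flag x ! k) k
      Fₖ-dim = proj₁ cx k 1≤k k≤n

      T⟨as⟩⊆Fₖ : ∀ {u} → u ∈⟨ as ⟩ → T · u ∈ₛ flag x ! k
      T⟨as⟩⊆Fₖ = ∈⟨⟩-elim A (λ u → T · u ∈ₛ flag x ! k) (subst (_∈ₛ flag x ! k) (sym (·-𝟎 T)) (subspace-𝟎 Fₖ-dim))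
        λ 1≤p u u∈ → flag-mono cx (ℕ.≤-trans 1≤p (proj₁ (proj₁ H₁ (toℕ p) 1≤p p≤n)))
                       (subst (m₁ ⟨ toℕ p ⟩ ≤_) m₁h≡k (Hessenberg-mono H₁ 1≤p (ℕ.n≤1+n (toℕ p)) (ℕ.<⇒≤ h<n))) k≤n
                       (T · u) (Tx⊆ (toℕ p) 1≤p p≤n p≢h u u∈)

      b∈⟨bs⟩ : b ∈⟨ bs ⟩
      b∈⟨bs⟩ = Basis.∈⇒∈⟨⟩ B (s≤s z≤n) b b∈Fₕ₊₁

      e-spec : ∃ λ e → e ∈⟨ bs ⟩ × e ∉⟨ b ∷ as ⟩
      e-spec = ∃∈⟨⟩∉⟨⟩ (b ∷ as) (Basis.indep B) (ℕ.n<1+n h)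

      e : 𝕍 n
      e = proj₁ e-spec

      Fₖ : Basis (flag x) k
      Fₖ = basis cx k≤n

      Fₖ₊₁ : Basis (flag x) (suc k)
      Fₖ₊₁ = basis cx k<n

      hs : Vec (𝕍 n) k
      hs = Basis.vecs Fₖ

      Te∈⟨Tb∷hs⟩ : T · e ∈⟨ T · b ∷ hs ⟩
      Te∈⟨Tb∷hs⟩ = independent-spans (LinIndep-∷ (Basis.indep Fₖ) Tb∉⟨hs⟩) Tb∷hs⊆
                     (Basis.∈⇒∈⟨⟩ Fₖ₊₁ (s≤s z≤n) _ (Tₕ₊₁⊆ e∈Fₕ₊₁))
        where
        Tₕ₊₁⊆ : ∀ {u} → u ∈ₛ flag x ! suc h → T · u ∈ₛ flag x ! suc k
        Tₕ₊₁⊆ {u} u∈ = subst (λ l → T · u ∈ₛ flag x ! l) m₁h+1≡k+1 (Tx⊆ (suc h) (s≤s z≤n) h<n h+1≢h u u∈)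

        e∈Fₕ₊₁ : e ∈ₛ flag x ! suc h
        e∈Fₕ₊₁ = Basis.∈⟨⟩⇒∈ B (s≤s z≤n) (proj₁ (proj₂ e-spec))

        Tb∉⟨hs⟩ : T · b ∉⟨ hs ⟩
        Tb∉⟨hs⟩ Tb∈ = Tb∉Fₖ (Basis.∈⟨⟩⇒∈ Fₖ 1≤k Tb∈)

        Tb∷hs⊆ : (T · b ∷ hs) ⊆⟨ Basis.vecs Fₖ₊₁ ⟩
        Tb∷hs⊆ = Basis.∈⇒∈⟨⟩ Fₖ₊₁ (s≤s z≤n) _ (Tₕ₊₁⊆ b∈Fₕ₊₁)
          ∷ᴬ All.map (λ {u} u∈ → Basis.∈⇒∈⟨⟩ Fₖ₊₁ (s≤s z≤n) u (proj₂ cx k 1≤k k<n (Basis.∈⟨⟩⇒∈ Fₖ 1≤k u∈))) (⊆⟨⟩-refl hs)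

      decomposition : ∃ λ α → ∃ λ ds → T · e ≡ α ⊙ T · b ⊕ ds ⊛ hs
      decomposition with Te∈⟨Tb∷hs⟩
      ... | α ∷ ds , eq = α , ds , sym eq

      α : Fin q
      α = proj₁ decomposition

      ds : Vec (Fin q) k
      ds = proj₁ (proj₂ decomposition)

    -- T induces a map from the plane B / A to the line V_(k+1) / V_k, nonzero on b, and the
    -- line spanned by w is its kernel.
    w : 𝕍 n
    w = e ⊕ (-F α) ⊙ b

    private
      Tw≡ : T · w ≡ ds ⊛ hs
      Tw≡ = begin
        T · (e ⊕ (-F α) ⊙ b)                     ≡⟨ ·-⊕ T e _ ⟩
        T · e ⊕ T · ((-F α) ⊙ b)                 ≡⟨ cong₂ _⊕_ (proj₂ (proj₂ decomposition)) (·-⊙ T (-F α) b) ⟩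
        α ⊙ T · b ⊕ ds ⊛ hs ⊕ (-F α) ⊙ T · b     ≡⟨ cong (_⊕ (-F α) ⊙ T · b) (⊕.comm _ _) ⟩
        ds ⊛ hs ⊕ α ⊙ T · b ⊕ (-F α) ⊙ T · b     ≡⟨ ⊕-cancel (ds ⊛ hs) (⊙-inverseʳ α (T · b)) ⟩
        ds ⊛ hs                                  ∎
        where open ≡-Reasoning

      Tw∈Fₖ : T · w ∈ₛ flag x ! k
      Tw∈Fₖ = Basis.∈⟨⟩⇒∈ Fₖ 1≤k (ds , sym Tw≡)

      w∈⟨bs⟩ : w ∈⟨ bs ⟩
      w∈⟨bs⟩ = ⊕∈⟨⟩ (proj₁ (proj₂ e-spec)) (⊙∈⟨⟩ (-F α) b∈⟨bs⟩)

      w∉⟨as⟩ : w ∉⟨ as ⟩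
      w∉⟨as⟩ w∈ = proj₂ (proj₂ e-spec)
        (subst (_∈⟨ b ∷ as ⟩) (⊕-cancel e (⊙-inverseˡ α b)) (⊕∈⟨⟩ (∈⟨∷⟩ w∈) (⊙∈⟨⟩ α head∈⟨∷⟩)))

      T⟨w∷as⟩⊆Fₖ : ∀ {u} → u ∈⟨ w ∷ as ⟩ → T · u ∈ₛ flag x ! k
      T⟨w∷as⟩⊆Fₖ u∈ = subspace-∈⟨⟩ Fₖ-dim (Tw∈Fₖ ∷ᴬ All.map⁺ (All.map T⟨as⟩⊆Fₖ (⊆⟨⟩-refl as))) (·-∈⟨⟩ T u∈)

    K : SubsetV 𝔽 n
    K = ⟦ w ∷ as ⟧

    K-isBetween : IsBetween as bs K
    K-isBetween = ⟦∷⟧-isBetween (Basis.indep A) as⊆bs w∈⟨bs⟩ w∉⟨as⟩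

    Hess₁-K : Hess m₁ (flag K)
    Hess₁-K = cK , TK⊆
      where
      cK : Complete (flag K)
      cK = between⇒complete K-isBetween

      TK⊆ : ∀ j → 1 ≤ j → j ≤ n → HessAt m₁ (flag K) j
      TK⊆ j 1≤j j≤n with j ℕ.≟ h
      ... | yes refl = λ u u∈ → subst (λ l → T · u ∈ₛ flag K ! l) (sym m₁h≡k) (subst (T · u ∈ₛ_) (flag-≢h k≢h x K)
                         (T⟨w∷as⟩⊆Fₖ (∈⟦⟧⇒∈⟨⟩ u (subst (u ∈ₛ_) (flag-h K) u∈))))
      ... | no j≢h   = HessAt-fibre {m₁} j≢h (h∉m₁ j 1≤j j≤n) (Tx⊆ j 1≤j j≤n j≢h)

    -- if w ∉ y then y + ⟨ w ⟩ = B ∋ b, so T b ∈ V_k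
    Hess₁⇒≡K : ∀ {y} → Hess m₁ (flag y) → K ≡ y
    Hess₁⇒≡K {y} (cy , Ty⊆) with w ∈ₛ? y
    ... | yes w∈y = sym (between-≡⟦∷⟧ (Basis.indep A) (complete⇒between cy) w w∈y w∉⟨as⟩)
    ... | no w∉y
      with y-dim@(ys , ys-indep , _) , _ , y⊆bs ← complete⇒between cy
      = ⊥-elim (Tb∉Fₖ Tb∈Fₖ)
      where
      T⟨ys⟩⊆Fₖ : ∀ {u} → u ∈⟨ ys ⟩ → T · u ∈ₛ flag x ! k
      T⟨ys⟩⊆Fₖ {u} u∈ = subst (T · u ∈ₛ_) (trans (cong (flag y !_) m₁h≡k) (flag-≢h k≢h y x))
        (Ty⊆ h 1≤h (ℕ.<⇒≤ h<n) u (subst (u ∈ₛ_) (sym (flag-h y)) (∈⟨⟩⇒∈ₛ y-dim u∈)))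

      b∈⟨w∷ys⟩ : b ∈⟨ w ∷ ys ⟩
      b∈⟨w∷ys⟩ = independent-spans (LinIndep-∷ ys-indep (λ w∈ → w∉y (∈⟨⟩⇒∈ₛ y-dim w∈)))
        (w∈⟨bs⟩ ∷ᴬ All.map (λ {u} u∈ → y⊆bs u (∈⟨⟩⇒∈ₛ y-dim u∈)) (⊆⟨⟩-refl ys)) b∈⟨bs⟩

      Tb∈Fₖ : T · b ∈ₛ flag x ! k
      Tb∈Fₖ = subspace-∈⟨⟩ Fₖ-dim (Tw∈Fₖ ∷ᴬ All.map⁺ (All.map T⟨ys⟩⊆Fₖ (⊆⟨⟩-refl ys))) (·-∈⟨⟩ T b∈⟨w∷ys⟩)

  Hess₁-unique : ∀ {x} → Hess m₂ (flag x) → ¬ Hess m₀ (flag x) → ∃! _≡_ (λ y → Hess m₁ (flag y))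
  Hess₁-unique hess₂ ¬hess₀ = K hess₂ ¬hess₀ , Hess₁-K hess₂ ¬hess₀ , Hess₁⇒≡K hess₂ ¬hess₀

module Identity {q : ℕ} (𝔽 : FiniteField q) {n′ : ℕ} (T : Matrix 𝔽 (suc n′))
                {m₀ m₁ m₂ : Vec ℕ (suc n′)}
                (H₀ : IsHessenberg (suc n′) m₀) (H₁ : IsHessenberg (suc n′) m₁) (H₂ : IsHessenberg (suc n′) m₂)
                (dec : ∀ (m : Vec ℕ (suc n′)) → Decidable (InHess 𝔽 m T)) where

  open Flags 𝔽 T

  Identity : Set
  Identity = (1 + q) * hessCount 𝔽 m₁ T (dec m₁) ≡ q * hessCount 𝔽 m₀ T (dec m₀) + hessCount 𝔽 m₂ T (dec m₂)

  identity-by-fibres : ∀ (p : Fin n) (h<n : suc (toℕ p) < n) → m₀ ≼ m₁ → m₁ ≼ m₂ →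
                       IsFreeAt m₀ (suc (toℕ p)) → IsFreeAt m₂ (suc (toℕ p)) →
                       (∀ R {x} → Hess m₂ (Fibre.flag R p h<n x) → ¬ Hess m₀ (Fibre.flag R p h<n x) →
                                  ∃! _≡_ (λ y → Hess m₁ (Fibre.flag R p h<n y))) →
                       Identity
  identity-by-fibres p h<n m₀≼m₁ m₁≼m₂ free₀ free₂ unique = fibrewise⇒identity p dec λ R →
    Fibre.fibre-identityᴴ R p h<n H₀ H₁ H₂ m₀≼m₁ m₁≼m₂ free₀ free₂ (unique R) dec

  module Shape₁ (i′ : ℕ) (p : Fin n) (i≤n′ : suc i′ ≤ n′)
                (m₁i-1<h : m₁ ⟨ i′ ⟩ < suc (toℕ p)) (h<m₁i+1 : suc (toℕ p) < m₁ ⟨ suc (suc i′) ⟩)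
                (m₁h≡m₁h+1 : m₁ ⟨ suc (toℕ p) ⟩ ≡ m₁ ⟨ suc (suc (toℕ p)) ⟩)
                (same : ∀ j → 1 ≤ j → j ≤ n → j ≢ suc i′ → m₀ ⟨ j ⟩ ≡ m₁ ⟨ j ⟩ × m₂ ⟨ j ⟩ ≡ m₁ ⟨ j ⟩)
                (m₁i≡h : m₁ ⟨ suc i′ ⟩ ≡ suc (toℕ p)) (m₀i≡h-1 : m₀ ⟨ suc i′ ⟩ ≡ toℕ p)
                (m₂i≡h+1 : m₂ ⟨ suc i′ ⟩ ≡ suc (suc (toℕ p))) where

    private
      i h : ℕ
      i = suc i′
      h = suc (toℕ p)

      i≤n : i ≤ n
      i≤n = ℕ.m≤n⇒m≤1+n i≤n′

      h<n : h < n
      h<n = ℕ.<-≤-trans h<m₁i+1 (proj₂ (proj₁ H₁ (suc i) (s≤s z≤n) (s≤s i≤n′)))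

      i<h : i < h
      i<h = s≤s (subst (i ≤_) m₀i≡h-1 (proj₁ (proj₁ H₀ i (s≤s z≤n) i≤n)))

      i≢h : i ≢ h
      i≢h = ℕ.<⇒≢ i<h

      h+1≢i : suc h ≢ i
      h+1≢i h+1≡i = ℕ.<⇒≢ (ℕ.m<n⇒m<1+n i<h) (sym h+1≡i)

      m₀≡m₁ : ∀ j → 1 ≤ j → j ≤ n → j ≢ i → m₀ ⟨ j ⟩ ≡ m₁ ⟨ j ⟩
      m₀≡m₁ j 1≤j j≤n j≢i = proj₁ (same j 1≤j j≤n j≢i)

      m₂≡m₁ : ∀ j → 1 ≤ j → j ≤ n → j ≢ i → m₂ ⟨ j ⟩ ≡ m₁ ⟨ j ⟩
      m₂≡m₁ j 1≤j j≤n j≢i = proj₂ (same j 1≤j j≤n j≢i)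

      -- m₁ is strictly increasing at i
      h∉m₁ : ∀ j → 1 ≤ j → j ≤ n → j ≢ i → m₁ ⟨ j ⟩ ≢ h
      h∉m₁ j 1≤j j≤n j≢i m₁j≡h with ℕ.<-cmp j i
      ... | tri≈ _ j≡i _       = j≢i j≡i
      ... | tri< (s≤s j≤i′) _ _ =
        ℕ.<-irrefl m₁j≡h (ℕ.≤-<-trans (Hessenberg-mono H₁ 1≤j j≤i′ (ℕ.≤-trans (ℕ.n≤1+n i′) i≤n)) m₁i-1<h)
      ... | tri> _ _ i<j       = ℕ.<-irrefl (sym m₁j≡h) (ℕ.<-≤-trans h<m₁i+1 (Hessenberg-mono H₁ (s≤s z≤n) i<j j≤n))

      m₀≼m₁ : m₀ ≼ m₁
      m₀≼m₁ j 1≤j j≤n with j ℕ.≟ i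
      ... | yes refl = subst₂ _≤_ (sym m₀i≡h-1) (sym m₁i≡h) (ℕ.n≤1+n (toℕ p))
      ... | no j≢i   = ℕ.≤-reflexive (m₀≡m₁ j 1≤j j≤n j≢i)

      m₁≼m₂ : m₁ ≼ m₂
      m₁≼m₂ j 1≤j j≤n with j ℕ.≟ i
      ... | yes refl = subst₂ _≤_ (sym m₁i≡h) (sym m₂i≡h+1) (ℕ.n≤1+n h)
      ... | no j≢i   = ℕ.≤-reflexive (sym (m₂≡m₁ j 1≤j j≤n j≢i))

      isFreeAt : ∀ {m} → (∀ j → 1 ≤ j → j ≤ n → j ≢ i → m ⟨ j ⟩ ≡ m₁ ⟨ j ⟩) → m ⟨ i ⟩ ≢ h → IsFreeAt m h
      isFreeAt {m} m≡m₁ mi≢h = h∉m , trans (m≡m₁ h (s≤s z≤n) (ℕ.<⇒≤ h<n) (≢-sym i≢h))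
                                           (trans m₁h≡m₁h+1 (sym (m≡m₁ (suc h) (s≤s z≤n) h<n h+1≢i)))
        where
        h∉m : ∀ j → 1 ≤ j → j ≤ n → m ⟨ j ⟩ ≢ h
        h∉m j 1≤j j≤n with j ℕ.≟ i
        ... | yes refl = mi≢h
        ... | no j≢i   = λ mj≡h → h∉m₁ j 1≤j j≤n j≢i (trans (sym (m≡m₁ j 1≤j j≤n j≢i)) mj≡h)

    identity : Identity
    identity = identity-by-fibres p h<n m₀≼m₁ m₁≼m₂
      (isFreeAt m₀≡m₁ λ m₀i≡h → ℕ.<⇒≢ (ℕ.n<1+n (toℕ p)) (trans (sym m₀i≡h-1) m₀i≡h))
      (isFreeAt m₂≡m₁ λ m₂i≡h → ℕ.1+n≢n (trans (sym m₂i≡h+1) m₂i≡h))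
      λ R → Case₁.Hess₁-unique 𝔽 T R p h<n H₁ i′ i<h m₁i≡h m₀i≡h-1 m₂i≡h+1 m₁i-1<h same h∉m₁ m₁h≡m₁h+1

  module Shape₂ (p : Fin n) (i≤n′ : suc (toℕ p) ≤ n′)
                (m₁i+1≡m₁i+1 : m₁ ⟨ suc (suc (toℕ p)) ⟩ ≡ suc (m₁ ⟨ suc (toℕ p) ⟩))
                (i∉m₁ : ∀ j → 1 ≤ j → j ≤ n → m₁ ⟨ j ⟩ ≢ suc (toℕ p))
                (same : ∀ j → 1 ≤ j → j ≤ n → j ≢ suc (toℕ p) → j ≢ suc (suc (toℕ p)) →
                        m₀ ⟨ j ⟩ ≡ m₁ ⟨ j ⟩ × m₂ ⟨ j ⟩ ≡ m₁ ⟨ j ⟩)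
                (m₀i≡m₁i : m₀ ⟨ suc (toℕ p) ⟩ ≡ m₁ ⟨ suc (toℕ p) ⟩)
                (m₀i+1≡m₁i : m₀ ⟨ suc (suc (toℕ p)) ⟩ ≡ m₁ ⟨ suc (toℕ p) ⟩)
                (m₂i≡m₁i+1 : m₂ ⟨ suc (toℕ p) ⟩ ≡ m₁ ⟨ suc (suc (toℕ p)) ⟩)
                (m₂i+1≡m₁i+1 : m₂ ⟨ suc (suc (toℕ p)) ⟩ ≡ m₁ ⟨ suc (suc (toℕ p)) ⟩) where

    private
      i k : ℕ
      i = suc (toℕ p)
      k = m₁ ⟨ i ⟩

      i<n : i < n
      i<n = s≤s i≤n′

      i<k : i < k
      i<k = ℕ.≤∧≢⇒< (proj₁ (proj₁ H₁ i (s≤s z≤n) (ℕ.<⇒≤ i<n))) (λ i≡k → i∉m₁ i (s≤s z≤n) (ℕ.<⇒≤ i<n) (sym i≡k))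

      k<n : k < n
      k<n = subst (_≤ n) m₁i+1≡m₁i+1 (proj₂ (proj₁ H₁ (suc i) (s≤s z≤n) i<n))

      k≢i : k ≢ i
      k≢i k≡i = ℕ.<⇒≢ i<k (sym k≡i)

      k+1≢i : suc k ≢ i
      k+1≢i k+1≡i = ℕ.<⇒≢ (ℕ.m<n⇒m<1+n i<k) (sym k+1≡i)

      m₀≼m₁ : m₀ ≼ m₁
      m₀≼m₁ j 1≤j j≤n with j ℕ.≟ i | j ℕ.≟ suc i
      ... | yes refl | _        = ℕ.≤-reflexive m₀i≡m₁i
      ... | no _     | yes refl = subst₂ _≤_ (sym m₀i+1≡m₁i) (sym m₁i+1≡m₁i+1) (ℕ.n≤1+n k)
      ... | no j≢i   | no j≢i+1 = ℕ.≤-reflexive (proj₁ (same j 1≤j j≤n j≢i j≢i+1))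

      m₁≼m₂ : m₁ ≼ m₂
      m₁≼m₂ j 1≤j j≤n with j ℕ.≟ i | j ℕ.≟ suc i
      ... | yes refl | _        = subst (k ≤_) (sym (trans m₂i≡m₁i+1 m₁i+1≡m₁i+1)) (ℕ.n≤1+n k)
      ... | no _     | yes refl = ℕ.≤-reflexive (sym m₂i+1≡m₁i+1)
      ... | no j≢i   | no j≢i+1 = ℕ.≤-reflexive (sym (proj₂ (same j 1≤j j≤n j≢i j≢i+1)))

      isFreeAt : ∀ {m} → (∀ j → 1 ≤ j → j ≤ n → j ≢ i → j ≢ suc i → m ⟨ j ⟩ ≡ m₁ ⟨ j ⟩) →
                 m ⟨ i ⟩ ≢ i → m ⟨ suc i ⟩ ≢ i → m ⟨ i ⟩ ≡ m ⟨ suc i ⟩ → IsFreeAt m i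
      isFreeAt {m} m≡m₁ mi≢i mi+1≢i mi≡mi+1 = i∉m , mi≡mi+1
        where
        i∉m : ∀ j → 1 ≤ j → j ≤ n → m ⟨ j ⟩ ≢ i
        i∉m j 1≤j j≤n with j ℕ.≟ i | j ℕ.≟ suc i
        ... | yes refl | _        = mi≢i
        ... | no _     | yes refl = mi+1≢i
        ... | no j≢i   | no j≢i+1 = λ mj≡i → i∉m₁ j 1≤j j≤n (trans (sym (m≡m₁ j 1≤j j≤n j≢i j≢i+1)) mj≡i)

      m₂i+1≡k+1 : m₂ ⟨ suc i ⟩ ≡ suc k
      m₂i+1≡k+1 = trans m₂i+1≡m₁i+1 m₁i+1≡m₁i+1

    identity : Identity
    identity = identity-by-fibres p i<n m₀≼m₁ m₁≼m₂
      (isFreeAt (λ j 1≤j j≤n j≢i j≢i+1 → proj₁ (same j 1≤j j≤n j≢i j≢i+1))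
        (λ m₀i≡i → k≢i (trans (sym m₀i≡m₁i) m₀i≡i)) (λ m₀i+1≡i → k≢i (trans (sym m₀i+1≡m₁i) m₀i+1≡i))
        (trans m₀i≡m₁i (sym m₀i+1≡m₁i)))
      (isFreeAt (λ j 1≤j j≤n j≢i j≢i+1 → proj₂ (same j 1≤j j≤n j≢i j≢i+1))
        (λ m₂i≡i → k+1≢i (trans (sym (trans m₂i≡m₁i+1 m₁i+1≡m₁i+1)) m₂i≡i))
        (λ m₂i+1≡i → k+1≢i (trans (sym m₂i+1≡k+1) m₂i+1≡i))
        (trans m₂i≡m₁i+1 (sym m₂i+1≡m₁i+1)))
      λ R → Case₂.Hess₁-unique 𝔽 T R p i<n H₁ k i<k k<n refl m₀i≡m₁i m₀i+1≡m₁i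
              m₂i+1≡m₁i+1 m₁i+1≡m₁i+1 same i∉m₁

  private
    +1≡suc : ∀ a → a + 1 ≡ suc a
    +1≡suc a = ℕ.+-comm a 1

    ⟨+1⟩ : ∀ (m : Vec ℕ n) j → m ⟨ j + 1 ⟩ ≡ m ⟨ suc j ⟩
    ⟨+1⟩ m j = cong (m ⟨_⟩) (+1≡suc j)

  identity₁ : Cond1 n m₀ m₁ m₂ → Identity
  identity₁ (suc i′ , _ , i≤n′ , m₁i-1<m₁i , m₁i<m₁i+1 , m₁h≡m₁h+1 , same , m₀i≡ , m₂i≡)
    with m₁ ⟨ suc i′ ⟩ in m₁i≡h
  ... | zero = case subst (suc i′ ≤_) m₁i≡h (proj₁ (proj₁ H₁ (suc i′) (s≤s z≤n) (ℕ.m≤n⇒m≤1+n i≤n′))) of λ ()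
  ... | suc h′ with fromℕ< h′<n | Fin.toℕ-fromℕ< h′<n
    where
    h′<n : h′ < n
    h′<n = ℕ.<⇒≤ (ℕ.<-≤-trans m₁i<m₁i+1 (proj₂ (proj₁ H₁ (suc (suc i′)) (s≤s z≤n) (s≤s i≤n′))))
  ...   | p | refl = Shape₁.identity i′ p i≤n′ m₁i-1<m₁i m₁i<m₁i+1
                       (trans m₁h≡m₁h+1 (⟨+1⟩ m₁ (suc h′))) same m₁i≡h m₀i≡ (trans m₂i≡ (+1≡suc (suc h′)))

  identity₂ : Cond2 n m₀ m₁ m₂ → Identity
  identity₂ (suc i′ , _ , i≤n′ , m₁i+1≡ , i∉m₁ , same , m₀i≡ , m₀i+1≡ , m₂i≡ , m₂i+1≡)
    with fromℕ< (ℕ.m≤n⇒m≤1+n i≤n′) | Fin.toℕ-fromℕ< (ℕ.m≤n⇒m≤1+n i≤n′)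
  ... | p | refl = Shape₂.identity p i≤n′ (trans (sym (⟨+1⟩ m₁ i)) (trans m₁i+1≡ (+1≡suc _))) i∉m₁
                     (λ j 1≤j j≤n j≢i j≢i+1 → same j 1≤j j≤n j≢i (λ j≡i+1 → j≢i+1 (trans j≡i+1 (+1≡suc i))))
                     m₀i≡ (trans (sym (⟨+1⟩ m₀ i)) m₀i+1≡) (trans m₂i≡ (⟨+1⟩ m₁ i))
                     (trans (sym (⟨+1⟩ m₂ i)) (trans m₂i+1≡ (⟨+1⟩ m₁ i)))
    where
    i : ℕ
    i = suc (toℕ p)

lemma3p3 : ∀ {q : ℕ} (𝔽 : FiniteField q) (n : ℕ) (T : Matrix 𝔽 n)
    (m₀ m₁ m₂ : Vec ℕ n) →
    IsHessenberg n m₀ → IsHessenberg n m₁ → IsHessenberg n m₂ →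
    Cond1 n m₀ m₁ m₂ ⊎ Cond2 n m₀ m₁ m₂ →
    (dec : ∀ (m : Vec ℕ n) → Decidable (InHess 𝔽 m T)) →
    (1 + q) * hessCount 𝔽 m₁ T (dec m₁)
    ≡ q * hessCount 𝔽 m₀ T (dec m₀) + hessCount 𝔽 m₂ T (dec m₂)
lemma3p3 𝔽 zero     T m₀ m₁ m₂ H₀ H₁ H₂ (inj₁ (i , 1≤i , i≤0 , _)) dec = ⊥-elim (ℕ.1+n≰n (ℕ.≤-trans 1≤i i≤0))
lemma3p3 𝔽 zero     T m₀ m₁ m₂ H₀ H₁ H₂ (inj₂ (i , 1≤i , i≤0 , _)) dec = ⊥-elim (ℕ.1+n≰n (ℕ.≤-trans 1≤i i≤0))
lemma3p3 𝔽 (suc n′) T m₀ m₁ m₂ H₀ H₁ H₂ (inj₁ cond₁) dec = Identity.identity₁ 𝔽 T H₀ H₁ H₂ dec cond₁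
lemma3p3 𝔽 (suc n′) T m₀ m₁ m₂ H₀ H₁ H₂ (inj₂ cond₂) dec = Identity.identity₂ 𝔽 T H₀ H₁ H₂ dec cond₂
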